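{- Let $p>3$ be a prime, $q=p^h$, and $a,b\in\mathbb{F}_{q^2}^*$. Suppose $f_{a,b}(X)=X(1+aX^{q(q-1)}+bX^{2(q-1)})$ is a permutation polynomial of $\mathbb{F}_{q^2}$ and that $\gcd(a^qX^3+X^2+b^q,\ bX^3+X+a)$ has degree $2$. Then there exists $v\in\mathbb{F}_q^*$ such that $b=v/a^2$, $v^2-a^{q+1}v-a^{3q+3}=0$, and $-3a^{2q+2}-4v$ is a nonzero square in $\mathbb{F}_q$.
   Context: A polynomial is a permutation polynomial of $\mathbb{F}_{q^2}$ if it induces a bijection of $\mathbb{F}_{q^2}$. The gcd is taken in $\mathbb{F}_{q^2}[X]$. -}

module Defs where

open import Level using (0ℓ)
open import Data.Nat as ℕ using (ℕ; zero; suc)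
open import Data.Fin using (Fin)
open import Data.List using (List; []; _∷_)
open import Data.Product using (Σ; ∃; _×_; _,_)
open import Relation.Binary.PropositionalEquality using (_≡_; _≢_)
open import Algebra.Core using (Op₁; Op₂)
open import Algebra.Structures using (IsCommutativeRing)
open import Function.Bundles using (_↔_)

-- A finite field with exactly n elements, with propositional equality
-- (every finite field is isomorphic to one of this form).
record FiniteField (n : ℕ) : Set₁ where
  infixl 7 _*_
  infixl 6 _+_
  infix  8 -_
  infix  9 _⁻¹
  field
    Carrier : Set
    _+_ _*_ : Op₂ Carrier
    -_ : Op₁ Carrier
    0# 1# : Carrier
    isCommutativeRing : IsCommutativeRing _≡_ _+_ _*_ -_ 0# 1#
    0≢1 : 0# ≢ 1#
    _⁻¹ : Op₁ Carrier
    inverseʳ : ∀ x → x ≢ 0# → x * (x ⁻¹) ≡ 1#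
    enumeration : Carrier ↔ Fin n

module FF {n : ℕ} (F : FiniteField n) where
  open FiniteField F

  infixr 8 _^_
  _^_ : Carrier → ℕ → Carrier
  x ^ zero = 1#
  x ^ suc k = x * (x ^ k)

  infixl 6 _-_
  _-_ : Carrier → Carrier → Carrier
  x - y = x + (- y)

  fromℕ : ℕ → Carrier
  fromℕ zero = 0#
  fromℕ (suc k) = 1# + fromℕ k

  InSubfield : ℕ → Carrier → Set
  InSubfield q x = x ^ q ≡ x

  NonzeroSquareIn : ℕ → Carrier → Set
  NonzeroSquareIn q x = x ≢ 0# × InSubfield q x × ∃ λ w → InSubfield q w × w * w ≡ x

  -- Polynomials over the field: coefficient lists, lowest degree first.
  Poly : Set
  Poly = List Carrier

  coeff : Poly → ℕ → Carrier
  coeff [] _ = 0#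
  coeff (c ∷ P) zero = c
  coeff (c ∷ P) (suc k) = coeff P k

  addP : Poly → Poly → Poly
  addP [] Q = Q
  addP P [] = P
  addP (c ∷ P) (d ∷ Q) = (c + d) ∷ addP P Q

  scaleP : Carrier → Poly → Poly
  scaleP c [] = []
  scaleP c (d ∷ Q) = (c * d) ∷ scaleP c Q

  mulP : Poly → Poly → Poly
  mulP [] Q = []
  mulP (c ∷ P) Q = addP (scaleP c Q) (0# ∷ mulP P Q)

  _≈P_ : Poly → Poly → Set
  P ≈P Q = ∀ k → coeff P k ≡ coeff Q k

  _∣P_ : Poly → Poly → Set
  D ∣P P = ∃ λ Q → mulP D Q ≈P P

  HasDegree : Poly → ℕ → Set
  HasDegree P d = coeff P d ≢ 0# × (∀ k → d ℕ.< k → coeff P k ≡ 0#)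

  GcdHasDegree : Poly → Poly → ℕ → Set
  GcdHasDegree P Q d =
    (∃ λ D → HasDegree D d × D ∣P P × D ∣P Q) ×
    (∀ D e → HasDegree D e → D ∣P P → D ∣P Q → e ℕ.≤ d)

  fab : ℕ → Carrier → Carrier → Carrier → Carrier
  fab q a b x = x * (1# + a * x ^ (q ℕ.* (q ℕ.∸ 1)) + b * x ^ (2 ℕ.* (q ℕ.∸ 1)))

-- A common quadratic factor of a^q X³ + X² + b^q and b X³ + X + a forces both cofactors to be
-- linear, and eliminating the coefficients of the factor and the cofactors leaves
-- b^q a^(2q) = b a² and a b² = a^(3q) + a^q b. The first says that v = b a² lies in F_q; the
-- second, multiplied by a³, is v² - s v - s³ = 0 with s = a^(q+1). The discriminant t = -3 s² - 4 v
-- lies in F_q. If it were not a nonzero square there, then, as every element of F_q is a square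
-- in F_(q²), t = r² with r^q = -r, and y = a (s + r) / 2v would satisfy b y³ + y + a = 0 and
-- y^(q+1) = 1. By Hilbert 90, y = x^(q-1) for some x ≢ 0, and then
-- f_{a,b}(x) = x (1 + a y^q + b y²) = 0 = f_{a,b}(0), contradicting injectivity.

module Submission where

open import Defs
open import Level using (0ℓ)
open import Data.Nat as ℕ using (ℕ; zero; suc; NonZero; _<_; _≤_)
open import Data.Fin as Fin using (Fin)
open import Data.Product using (∃; _×_; _,_; proj₁; proj₂)
open import Data.List using (_∷_; []; length)
open import Data.Sum using (_⊎_; inj₁; inj₂)
open import Data.Empty using (⊥; ⊥-elim)
open import Data.Maybe using (Maybe; just; nothing)
open import Relation.Nullary using (Dec; yes; no)
open import Relation.Nullary.Decidable using (⌊_⌋; ¬?; _×-dec_)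
open import Data.Bool using (Bool; true; false; if_then_else_)
open import Relation.Binary.PropositionalEquality
  using (_≡_; _≢_; refl; sym; trans; cong; cong₂; subst; module ≡-Reasoning)
open import Algebra.Bundles using (CommutativeMonoid; CommutativeSemiring; CommutativeRing; RawRing)
open import Data.Vec.Functional using (removeAt)
import Algebra.Properties.CommutativeMonoid.Sum
import Algebra.Properties.CommutativeSemiring.Binomial
import Algebra.Definitions.RawSemiring
open import Function.Bundles using (Inverse)
open import Function.Base using (id)
open import Function.Definitions using (Bijective)
open import Data.Fin.Permutation using (Permutation; permutation)
open import Data.Nat.Primality using (Prime)
import Data.Nat.Properties as ℕₚ
open import Data.Nat.Divisibility using (_∣_; divides; ∣⇒≤; m%n≡0⇒n∣m)
open import Data.Nat.DivMod using (_%_; _/_; m≡m%n+[m/n]*n; m%n<n)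
import Data.Nat.Primality as Prime
open import Data.Nat.Combinatorics using (_C_; nCk+nC[k+1]≡[n+1]C[k+1]; nC1≡n; nCn≡1)
open import Data.Nat.GCD using (module Bézout)
open import Data.Nat.Coprimality using (prime⇒coprime; coprime-Bézout)
import Data.Nat.Tactic.RingSolver as ℕ-Solver
import Data.Fin.Properties as Fin
import Algebra.Solver.Ring
import Algebra.Solver.Ring.AlmostCommutativeRing as ACR
import Tactic.RingSolver.Core.AlmostCommutativeRing as TACR
import Tactic.RingSolver.NonReflective

module _ where
  open import Data.Nat using (_+_; _*_; _^_; _<_)
  open ≡-Reasoning

  [1+k]*[1+n]C[1+k]≡[1+n]*nCk : ∀ n k → suc k * (suc n C suc k) ≡ suc n * (n C k)
  [1+k]*[1+n]C[1+k]≡[1+n]*nCk n zero =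
    trans (ℕₚ.*-identityˡ _) (trans (nC1≡n (suc n)) (sym (ℕₚ.*-identityʳ (suc n))))
  [1+k]*[1+n]C[1+k]≡[1+n]*nCk zero (suc k) = ℕₚ.*-zeroʳ (suc (suc k))
  [1+k]*[1+n]C[1+k]≡[1+n]*nCk (suc m) (suc j) = begin
      suc (suc j) * (suc (suc m) C suc (suc j))
        ≡⟨ cong (suc (suc j) *_) (sym (nCk+nC[k+1]≡[n+1]C[k+1] (suc m) (suc j))) ⟩
      suc (suc j) * (A + B)                        ≡⟨ expand (suc j) A B ⟩
      suc j * A + A + suc (suc j) * B
        ≡⟨ cong₂ (λ u w → u + A + w) ([1+k]*[1+n]C[1+k]≡[1+n]*nCk m j) ([1+k]*[1+n]C[1+k]≡[1+n]*nCk m (suc j)) ⟩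
      suc m * (m C j) + A + suc m * (m C suc j)
        ≡⟨ cong (λ u → suc m * (m C j) + u + suc m * (m C suc j)) (sym (nCk+nC[k+1]≡[n+1]C[k+1] m j)) ⟩
      suc m * (m C j) + (m C j + m C suc j) + suc m * (m C suc j) ≡⟨ collect (suc m) (m C j) (m C suc j) ⟩
      suc (suc m) * (m C j + m C suc j)            ≡⟨ cong (suc (suc m) *_) (nCk+nC[k+1]≡[n+1]C[k+1] m j) ⟩
      suc (suc m) * (suc m C suc j)                ∎
    where
    A B : ℕ
    A = suc m C suc j
    B = suc m C suc (suc j)
    expand : ∀ a x y → suc a * (x + y) ≡ a * x + x + suc a * y
    expand = ℕ-Solver.solve-∀
    collect : ∀ a x y → a * x + (x + y) + a * y ≡ suc a * (x + y)
    collect = ℕ-Solver.solve-∀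

  prime∣pC[1+k] : ∀ {n} → Prime (suc n) → ∀ k → suc k < suc n → suc n ∣ suc n C suc k
  prime∣pC[1+k] {n} pp k k<n
    with Prime.euclidsLemma (suc k) (suc n C suc k) pp
           (divides (n C k) (trans ([1+k]*[1+n]C[1+k]≡[1+n]*nCk n k) (ℕₚ.*-comm (suc n) (n C k))))
  ... | inj₁ p∣1+k = ⊥-elim (ℕₚ.<⇒≱ k<n (∣⇒≤ p∣1+k))
  ... | inj₂ p∣C = p∣C

  odd^n-odd : ∀ k n → ∃ λ u → suc (k * 2) ^ n ≡ suc (u + u)
  odd^n-odd k zero = 0 , refl
  odd^n-odd k (suc n) with odd^n-odd k n
  ... | u , e = u + k + k * 2 * u , trans (cong (suc (k * 2) *_) e) (product k u)
    where
    product : ∀ k u → suc (k * 2) * suc (u + u) ≡ suc ((u + k + k * 2 * u) + (u + k + k * 2 * u))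
    product = ℕ-Solver.solve-∀

  odd-prime : ∀ {p} → Prime p → 2 < p → ∃ λ k → p ≡ suc (k * 2)
  odd-prime {p} pp 2<p with p % 2 | m≡m%n+[m/n]*n p 2 | m%n<n p 2 | m%n≡0⇒n∣m p 2
  ... | zero | _ | _ | 2∣p with Prime.prime⇒irreducible pp (2∣p refl)
  ...   | inj₁ ()
  ...   | inj₂ refl = ⊥-elim (ℕₚ.<-irrefl refl 2<p)
  odd-prime {p} pp 2<p | suc zero | p≡1+[p/2]*2 | _ | _ = p / 2 , p≡1+[p/2]*2
  odd-prime {p} pp 2<p | suc (suc _) | _ | ℕ.s≤s (ℕ.s≤s ()) | _

  m+m≡n+n⇒m≡n : ∀ {m n} → m + m ≡ n + n → m ≡ n
  m+m≡n+n⇒m≡n {m} {n} e =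
    ℕₚ.*-cancelˡ-≡ m n 2 (trans (cong (m +_) (ℕₚ.+-identityʳ m)) (trans e (cong (n +_) (sym (ℕₚ.+-identityʳ n)))))

module _ (M : CommutativeMonoid 0ℓ 0ℓ) where
  open CommutativeMonoid M using (Carrier; _≈_; _∙_; ε; setoid; ∙-congˡ; identityʳ)
    renaming (trans to ≈-trans)
  open Algebra.Properties.CommutativeMonoid.Sum M using (sum; sum-remove; sum-cong-≋; sum-replicate-zero)
  open import Relation.Binary.Reasoning.Setoid setoid

  sum-ε : ∀ {n} (t : Fin n → Carrier) → (∀ j → t j ≈ ε) → sum t ≈ ε
  sum-ε {n} t t≈ε = ≈-trans (sum-cong-≋ t≈ε) (sum-replicate-zero n)

  sum-single : ∀ {n} (t : Fin n → Carrier) i → (∀ j → j ≢ i → t j ≈ ε) → sum t ≈ t i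
  sum-single {suc n} t i t≈ε = begin
    sum t                         ≈⟨ sum-remove t ⟩
    t i ∙ sum (removeAt t i)      ≈⟨ ∙-congˡ (sum-ε (removeAt t i) (λ j → t≈ε (Fin.punchIn i j) (Fin.punchInᵢ≢i i j))) ⟩
    t i ∙ ε                       ≈⟨ identityʳ (t i) ⟩
    t i                           ∎

injective⇒surjective : ∀ {n} (f : Fin n → Fin n) → (∀ {i j} → f i ≡ f j → i ≡ j) → ∀ k → ∃ λ i → f i ≡ k
injective⇒surjective {suc n} f f-injective k with Fin.any? (λ i → f i Fin.≟ k)
... | yes found = found
... | no missing = ⊥-elim (ℕₚ.<-irrefl refl (Fin.injective⇒≤ {f = squeezed} squeezed-injective))
  where
  misses : ∀ i → k ≢ f i
  misses i e = missing (i , sym e)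
  squeezed : Fin (suc n) → Fin n
  squeezed i = Fin.punchOut (misses i)
  squeezed-injective : ∀ {i j} → squeezed i ≡ squeezed j → i ≡ j
  squeezed-injective e = f-injective (Fin.punchOut-injective (misses _) (misses _) e)

module FiniteFieldTheory {N : ℕ} (F : FiniteField N) where
  open FiniteField F
  open FF F

  commutativeRing : CommutativeRing 0ℓ 0ℓ
  commutativeRing = record { isCommutativeRing = isCommutativeRing }

  open CommutativeRing commutativeRing
    using (+-assoc; +-comm; *-assoc; *-comm; distribˡ; distribʳ; +-identityˡ; +-identityʳ;
           *-identityˡ; *-identityʳ; -‿inverseʳ; -‿inverseˡ; zeroˡ; zeroʳ)
  open ≡-Reasoning

  -- Without a zero test on coefficients this solver cannot cancel x - x; it only serves to set
  -- up the solver with integer coefficients below.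
  module Bootstrap = Tactic.RingSolver.NonReflective
    (TACR.fromCommutativeRing commutativeRing (λ _ → nothing))

  [x+z]-[y+w]≡[x-y]+[z-w] : ∀ x y z w → (x + z) - (y + w) ≡ (x - y) + (z - w)
  [x+z]-[y+w]≡[x-y]+[z-w] = solve 4 (λ x y z w → ((x ⊕ z) ⊕ (⊝ (y ⊕ w))) ⊜ ((x ⊕ (⊝ y)) ⊕ (z ⊕ (⊝ w)))) refl
    where open Bootstrap

  [xz+yw]-[xw+yz]≡[x-y][z-w] : ∀ x y z w → (x * z + y * w) - (x * w + y * z) ≡ (x - y) * (z - w)
  [xz+yw]-[xw+yz]≡[x-y][z-w] x y z w = trans (regroup (x * z) (y * w) (x * w) (y * z)) (sym expand)
    where
    open Bootstrap
    open import Algebra.Properties.Ring (CommutativeRing.ring commutativeRing)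
      using (-‿distribˡ-*; -‿distribʳ-*; -‿involutive)
    regroup : ∀ a b c d → (a + b) - (c + d) ≡ (a + (- c)) + ((- d) + b)
    regroup = solve 4 (λ a b c d → ((a ⊕ b) ⊕ (⊝ (c ⊕ d))) ⊜ ((a ⊕ (⊝ c)) ⊕ ((⊝ d) ⊕ b))) refl
    expand : (x - y) * (z - w) ≡ (x * z + (- (x * w))) + ((- (y * z)) + y * w)
    expand = trans (distribʳ (z - w) x (- y))
      (cong₂ _+_ (trans (distribˡ x z (- w)) (cong (x * z +_) (sym (-‿distribʳ-* x w))))
                 (trans (distribˡ (- y) z (- w))
                   (cong₂ _+_ (sym (-‿distribˡ-* y z))
                     (trans (sym (-‿distribˡ-* y (- w))) (trans (cong -_ (sym (-‿distribʳ-* y w))) (-‿involutive (y * w)))))))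

  -[x-y]≡y-x : ∀ x y → - (x - y) ≡ y - x
  -[x-y]≡y-x = ⁻¹-anti-homo‿-
    where open import Algebra.Properties.AbelianGroup (CommutativeRing.+-abelianGroup commutativeRing)

  [x+y]-y≡x : ∀ x y → (x + y) - y ≡ x
  [x+y]-y≡x x y = trans (+-assoc x y (- y)) (trans (cong (x +_) (-‿inverseʳ y)) (+-identityʳ x))

  x+w≡z+y⇒x-y≡z-w : ∀ {x y z w} → x + w ≡ z + y → x - y ≡ z - w
  x+w≡z+y⇒x-y≡z-w {x} {y} {z} {w} e = begin
      x - y               ≡⟨ cong (_- y) (sym ([x+y]-y≡x x w)) ⟩
      ((x + w) - w) - y   ≡⟨ cong (λ u → (u - w) - y) e ⟩
      ((z + y) - w) - y   ≡⟨ swap (z + y) w y ⟩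
      ((z + y) - y) - w   ≡⟨ cong (_- w) ([x+y]-y≡x z y) ⟩
      z - w               ∎
    where
    open Bootstrap
    swap : ∀ a b c → (a - b) - c ≡ (a - c) - b
    swap = solve 3 (λ a b c → ((a ⊕ (⊝ b)) ⊕ (⊝ c)) ⊜ ((a ⊕ (⊝ c)) ⊕ (⊝ b))) refl

  -0#≡0# : - 0# ≡ 0#
  -0#≡0# = trans (sym (+-identityˡ (- 0#))) (-‿inverseʳ 0#)

  fromℕ-homo-+ : ∀ m n → fromℕ (m ℕ.+ n) ≡ fromℕ m + fromℕ n
  fromℕ-homo-+ zero n = sym (+-identityˡ (fromℕ n))
  fromℕ-homo-+ (suc m) n = trans (cong (1# +_) (fromℕ-homo-+ m n)) (sym (+-assoc 1# (fromℕ m) (fromℕ n)))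

  fromℕ-homo-* : ∀ m n → fromℕ (m ℕ.* n) ≡ fromℕ m * fromℕ n
  fromℕ-homo-* zero n = sym (zeroˡ (fromℕ n))
  fromℕ-homo-* (suc m) n = begin
    fromℕ (n ℕ.+ m ℕ.* n)          ≡⟨ fromℕ-homo-+ n (m ℕ.* n) ⟩
    fromℕ n + fromℕ (m ℕ.* n)      ≡⟨ cong₂ _+_ (sym (*-identityˡ (fromℕ n))) (fromℕ-homo-* m n) ⟩
    1# * fromℕ n + fromℕ m * fromℕ n ≡⟨ sym (distribʳ (fromℕ n) 1# (fromℕ m)) ⟩
    (1# + fromℕ m) * fromℕ n       ∎

  fromℕ-homo-^ : ∀ m k → fromℕ (m ℕ.^ k) ≡ fromℕ m ^ k
  fromℕ-homo-^ m zero = +-identityʳ 1#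
  fromℕ-homo-^ m (suc k) = trans (fromℕ-homo-* m (m ℕ.^ k)) (cong (fromℕ m *_) (fromℕ-homo-^ m k))

  -- The ring solver with integer coefficients, written as formal differences (m , n) of
  -- naturals: equality of coefficients is then decidable by computation, and fromℕ′ makes
  -- the interpretation send (0 , 0) and (1 , 0) to 0# and 1# definitionally.
  ℤ-rawRing : RawRing 0ℓ 0ℓ
  ℤ-rawRing = record
    { Carrier = ℕ × ℕ
    ; _≈_ = _≡_
    ; _+_ = λ { (a , b) (c , d) → (a ℕ.+ c , b ℕ.+ d) }
    ; _*_ = λ { (a , b) (c , d) → (a ℕ.* c ℕ.+ b ℕ.* d , a ℕ.* d ℕ.+ b ℕ.* c) }
    ; -_ = λ { (a , b) → (b , a) }
    ; 0# = (0 , 0)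
    ; 1# = (1 , 0)
    }

  fromℕ′ : ℕ → Carrier
  fromℕ′ zero = 0#
  fromℕ′ (suc zero) = 1#
  fromℕ′ (suc (suc n)) = 1# + fromℕ′ (suc n)

  fromℕ′≡fromℕ : ∀ n → fromℕ′ n ≡ fromℕ n
  fromℕ′≡fromℕ zero = refl
  fromℕ′≡fromℕ (suc zero) = sym (+-identityʳ 1#)
  fromℕ′≡fromℕ (suc (suc n)) = cong (1# +_) (fromℕ′≡fromℕ (suc n))

  fromℤ : ℕ × ℕ → Carrier
  fromℤ (a , zero) = fromℕ′ a
  fromℤ (zero , suc b) = - fromℕ′ (suc b)
  fromℤ (suc a , suc b) = fromℤ (a , b)

  fromℤ≡fromℕ-fromℕ : ∀ x → fromℤ x ≡ fromℕ (proj₁ x) - fromℕ (proj₂ x)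
  fromℤ≡fromℕ-fromℕ (a , zero) = trans (fromℕ′≡fromℕ a) (sym (trans (cong (fromℕ a +_) -0#≡0#) (+-identityʳ _)))
  fromℤ≡fromℕ-fromℕ (zero , suc b) = sym (trans (+-identityˡ _) (cong -_ (sym (fromℕ′≡fromℕ (suc b)))))
  fromℤ≡fromℕ-fromℕ (suc a , suc b) = trans (fromℤ≡fromℕ-fromℕ (a , b)) (sym (begin
    (1# + fromℕ a) - (1# + fromℕ b)   ≡⟨ [x+z]-[y+w]≡[x-y]+[z-w] 1# 1# (fromℕ a) (fromℕ b) ⟩
    (1# - 1#) + (fromℕ a - fromℕ b)   ≡⟨ cong (_+ (fromℕ a - fromℕ b)) (-‿inverseʳ 1#) ⟩
    0# + (fromℕ a - fromℕ b)          ≡⟨ +-identityˡ _ ⟩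
    fromℕ a - fromℕ b                 ∎))

  almostCommutativeRing : ACR.AlmostCommutativeRing 0ℓ 0ℓ
  almostCommutativeRing = ACR.fromCommutativeRing commutativeRing

  fromℤ-morphism : ℤ-rawRing ACR.-Raw-AlmostCommutative⟶ almostCommutativeRing
  fromℤ-morphism = record
    { ⟦_⟧ = fromℤ
    ; +-homo = λ { x@(a , b) y@(c , d) → begin
        fromℤ (a ℕ.+ c , b ℕ.+ d)                   ≡⟨ fromℤ≡fromℕ-fromℕ (a ℕ.+ c , b ℕ.+ d) ⟩
        fromℕ (a ℕ.+ c) - fromℕ (b ℕ.+ d)           ≡⟨ cong₂ _-_ (fromℕ-homo-+ a c) (fromℕ-homo-+ b d) ⟩
        (fromℕ a + fromℕ c) - (fromℕ b + fromℕ d)   ≡⟨ [x+z]-[y+w]≡[x-y]+[z-w] _ _ _ _ ⟩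
        (fromℕ a - fromℕ b) + (fromℕ c - fromℕ d)   ≡⟨ sym (cong₂ _+_ (fromℤ≡fromℕ-fromℕ x) (fromℤ≡fromℕ-fromℕ y)) ⟩
        fromℤ x + fromℤ y                           ∎ }
    ; *-homo = λ { x@(a , b) y@(c , d) → begin
        fromℤ (a ℕ.* c ℕ.+ b ℕ.* d , a ℕ.* d ℕ.+ b ℕ.* c)
          ≡⟨ fromℤ≡fromℕ-fromℕ (a ℕ.* c ℕ.+ b ℕ.* d , a ℕ.* d ℕ.+ b ℕ.* c) ⟩
        fromℕ (a ℕ.* c ℕ.+ b ℕ.* d) - fromℕ (a ℕ.* d ℕ.+ b ℕ.* c)
          ≡⟨ cong₂ _-_ (fromℕ-homo-+-* a c b d) (fromℕ-homo-+-* a d b c) ⟩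
        (fromℕ a * fromℕ c + fromℕ b * fromℕ d) - (fromℕ a * fromℕ d + fromℕ b * fromℕ c)
          ≡⟨ [xz+yw]-[xw+yz]≡[x-y][z-w] _ _ _ _ ⟩
        (fromℕ a - fromℕ b) * (fromℕ c - fromℕ d)
          ≡⟨ sym (cong₂ _*_ (fromℤ≡fromℕ-fromℕ x) (fromℤ≡fromℕ-fromℕ y)) ⟩
        fromℤ x * fromℤ y ∎ }
    ; -‿homo = λ { x@(a , b) → begin
        fromℤ (b , a)              ≡⟨ fromℤ≡fromℕ-fromℕ (b , a) ⟩
        fromℕ b - fromℕ a          ≡⟨ sym (-[x-y]≡y-x (fromℕ a) (fromℕ b)) ⟩
        - (fromℕ a - fromℕ b)      ≡⟨ cong -_ (sym (fromℤ≡fromℕ-fromℕ x)) ⟩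
        - fromℤ x                  ∎ }
    ; 0-homo = refl
    ; 1-homo = refl
    }
    where
    fromℕ-homo-+-* : ∀ a b c d → fromℕ (a ℕ.* b ℕ.+ c ℕ.* d) ≡ fromℕ a * fromℕ b + fromℕ c * fromℕ d
    fromℕ-homo-+-* a b c d =
      trans (fromℕ-homo-+ (a ℕ.* b) (c ℕ.* d)) (cong₂ _+_ (fromℕ-homo-* a b) (fromℕ-homo-* c d))

  ℤ-coefficient≟ : ∀ x y → Maybe (fromℤ x ≡ fromℤ y)
  ℤ-coefficient≟ x@(a , b) y@(c , d) with (a ℕ.+ d) ℕ.≟ (c ℕ.+ b)
  ... | no _ = nothing
  ... | yes e = just (begin
    fromℤ x             ≡⟨ fromℤ≡fromℕ-fromℕ x ⟩
    fromℕ a - fromℕ b   ≡⟨ x+w≡z+y⇒x-y≡z-w (trans (sym (fromℕ-homo-+ a d)) (trans (cong fromℕ e) (fromℕ-homo-+ c b))) ⟩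
    fromℕ c - fromℕ d   ≡⟨ sym (fromℤ≡fromℕ-fromℕ y) ⟩
    fromℤ y             ∎)

  open Algebra.Solver.Ring ℤ-rawRing almostCommutativeRing fromℤ-morphism ℤ-coefficient≟
    using (Polynomial; con; solve; _:+_; _:*_; :-_; _:-_; _:=_)

  κ : ∀ {m} → ℕ → Polynomial m
  κ n = con (n , 0)

  toFin : Carrier → Fin N
  toFin = Inverse.to enumeration

  fromFin : Fin N → Carrier
  fromFin = Inverse.from enumeration

  toFin-fromFin : ∀ i → toFin (fromFin i) ≡ i
  toFin-fromFin i = Inverse.inverseˡ enumeration refl

  fromFin-toFin : ∀ x → fromFin (toFin x) ≡ x
  fromFin-toFin x = Inverse.inverseʳ enumeration refl

  toFin-injective : ∀ {x y} → toFin x ≡ toFin y → x ≡ y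
  toFin-injective {x} {y} e = trans (sym (fromFin-toFin x)) (trans (cong fromFin e) (fromFin-toFin y))

  infix 4 _≟_
  _≟_ : (x y : Carrier) → Dec (x ≡ y)
  x ≟ y with toFin x Fin.≟ toFin y
  ... | yes e = yes (toFin-injective e)
  ... | no ne = no (λ e → ne (cong toFin e))

  any? : {P : Carrier → Set} → (∀ x → Dec (P x)) → Dec (∃ P)
  any? {P} P? with Fin.any? (λ i → P? (fromFin i))
  ... | yes (i , pi) = yes (fromFin i , pi)
  ... | no ¬pi = no (λ { (x , px) → ¬pi (toFin x , subst P (sym (fromFin-toFin x)) px) })

  1#≢0# : 1# ≢ 0#
  1#≢0# e = 0≢1 (sym e)

  inverseˡ : ∀ x → x ≢ 0# → x ⁻¹ * x ≡ 1#
  inverseˡ x x≢0 = trans (*-comm (x ⁻¹) x) (inverseʳ x x≢0)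

  *-cancelˡ : ∀ {c x y} → c ≢ 0# → c * x ≡ c * y → x ≡ y
  *-cancelˡ {c} {x} {y} c≢0 e = begin
      x                ≡⟨ sym (*-identityˡ x) ⟩
      1# * x           ≡⟨ cong (_* x) (sym (inverseˡ c c≢0)) ⟩
      (c ⁻¹ * c) * x   ≡⟨ *-assoc (c ⁻¹) c x ⟩
      c ⁻¹ * (c * x)   ≡⟨ cong (c ⁻¹ *_) e ⟩
      c ⁻¹ * (c * y)   ≡⟨ sym (*-assoc (c ⁻¹) c y) ⟩
      (c ⁻¹ * c) * y   ≡⟨ cong (_* y) (inverseˡ c c≢0) ⟩
      1# * y           ≡⟨ *-identityˡ y ⟩
      y                ∎

  x*y≡0⇒x≡0⊎y≡0 : ∀ {x y} → x * y ≡ 0# → x ≡ 0# ⊎ y ≡ 0#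
  x*y≡0⇒x≡0⊎y≡0 {x} {y} e with x ≟ 0#
  ... | yes x≡0 = inj₁ x≡0
  ... | no x≢0 = inj₂ (*-cancelˡ x≢0 (trans e (sym (zeroʳ x))))

  x≡0⇒c*x≡0 : ∀ {c x} → x ≡ 0# → c * x ≡ 0#
  x≡0⇒c*x≡0 {c} refl = zeroʳ c

  x*y≢0 : ∀ {x y} → x ≢ 0# → y ≢ 0# → x * y ≢ 0#
  x*y≢0 x≢0 y≢0 e with x*y≡0⇒x≡0⊎y≡0 e
  ... | inj₁ x≡0 = x≢0 x≡0
  ... | inj₂ y≡0 = y≢0 y≡0

  ⁻¹-unique : ∀ {x y} → x * y ≡ 1# → y ≡ x ⁻¹
  ⁻¹-unique {x} {y} e with x ≟ 0#
  ... | yes refl = ⊥-elim (0≢1 (trans (sym (zeroˡ y)) e))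
  ... | no x≢0 = *-cancelˡ x≢0 (trans e (sym (inverseʳ x x≢0)))

  ⁻¹-involutive : ∀ {x} → x ≢ 0# → (x ⁻¹) ⁻¹ ≡ x
  ⁻¹-involutive {x} x≢0 = sym (⁻¹-unique (inverseˡ x x≢0))

  -‿unique : ∀ {x y} → x + y ≡ 0# → y ≡ - x
  -‿unique {x} {y} e = begin
      y              ≡⟨ sym ([x+y]-y≡x y x) ⟩
      (y + x) - x    ≡⟨ cong (_- x) (trans (+-comm y x) e) ⟩
      0# - x         ≡⟨ +-identityˡ (- x) ⟩
      - x            ∎

  x-y≡0⇒x≡y : ∀ {x y} → x - y ≡ 0# → x ≡ y
  x-y≡0⇒x≡y {x} {y} e = begin
      x              ≡⟨ sym ([x+y]-y≡x x y) ⟩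
      (x + y) - y    ≡⟨ cong (_- y) (+-comm x y) ⟩
      (y + x) - y    ≡⟨ +-assoc y x (- y) ⟩
      y + (x - y)    ≡⟨ cong (y +_) e ⟩
      y + 0#         ≡⟨ +-identityʳ y ⟩
      y              ∎

  x≡y⇒x-y≡0 : ∀ {x y} → x ≡ y → x - y ≡ 0#
  x≡y⇒x-y≡0 {x} refl = -‿inverseʳ x

  -1*-1≡1 : (- 1#) * (- 1#) ≡ 1#
  -1*-1≡1 = solve 0 (:- κ 1 :* :- κ 1 := κ 1) refl

  ^-distribˡ-+-* : ∀ x m n → x ^ (m ℕ.+ n) ≡ x ^ m * x ^ n
  ^-distribˡ-+-* x zero n = sym (*-identityˡ (x ^ n))
  ^-distribˡ-+-* x (suc m) n = trans (cong (x *_) (^-distribˡ-+-* x m n)) (sym (*-assoc x (x ^ m) (x ^ n)))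

  ^-distribʳ-* : ∀ x y n → (x * y) ^ n ≡ x ^ n * y ^ n
  ^-distribʳ-* x y zero = sym (*-identityˡ 1#)
  ^-distribʳ-* x y (suc n) = trans (cong ((x * y) *_) (^-distribʳ-* x y n))
    (solve 4 (λ x y X Y → (x :* y) :* (X :* Y) := (x :* X) :* (y :* Y)) refl x y (x ^ n) (y ^ n))

  1^n≡1 : ∀ n → 1# ^ n ≡ 1#
  1^n≡1 zero = refl
  1^n≡1 (suc n) = trans (*-identityˡ _) (1^n≡1 n)

  ^-*-assoc : ∀ x m n → x ^ (m ℕ.* n) ≡ (x ^ m) ^ n
  ^-*-assoc x zero n = sym (1^n≡1 n)
  ^-*-assoc x (suc m) n = begin
      x ^ (n ℕ.+ m ℕ.* n)        ≡⟨ ^-distribˡ-+-* x n (m ℕ.* n) ⟩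
      x ^ n * x ^ (m ℕ.* n)      ≡⟨ cong (x ^ n *_) (^-*-assoc x m n) ⟩
      x ^ n * (x ^ m) ^ n        ≡⟨ sym (^-distribʳ-* x (x ^ m) n) ⟩
      (x * x ^ m) ^ n            ∎

  ^-comm : ∀ x m n → (x ^ m) ^ n ≡ (x ^ n) ^ m
  ^-comm x m n = trans (sym (^-*-assoc x m n)) (trans (cong (x ^_) (ℕₚ.*-comm m n)) (^-*-assoc x n m))

  x^n≢0 : ∀ {x} n → x ≢ 0# → x ^ n ≢ 0#
  x^n≢0 zero x≢0 = 1#≢0#
  x^n≢0 (suc n) x≢0 = x*y≢0 x≢0 (x^n≢0 n x≢0)

  x^n≡0⇒x≡0 : ∀ {x} n → x ^ n ≡ 0# → x ≡ 0#
  x^n≡0⇒x≡0 {x} n e with x ≟ 0#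
  ... | yes x≡0 = x≡0
  ... | no x≢0 = ⊥-elim (x^n≢0 n x≢0 e)

  0^n≡0 : ∀ {n} → 0 ℕ.< n → 0# ^ n ≡ 0#
  0^n≡0 {suc n} _ = zeroˡ _

  infix 4 _≟ᵇ_
  _≟ᵇ_ : Carrier → Carrier → Bool
  x ≟ᵇ y = ⌊ x ≟ y ⌋

  ≟ᵇ-refl : ∀ x → (x ≟ᵇ x) ≡ true
  ≟ᵇ-refl x with x ≟ x
  ... | yes _ = refl
  ... | no x≢x = ⊥-elim (x≢x refl)

  ≟ᵇ-≢ : ∀ {x y} → x ≢ y → (x ≟ᵇ y) ≡ false
  ≟ᵇ-≢ {x} {y} x≢y with x ≟ y
  ... | yes x≡y = ⊥-elim (x≢y x≡y)
  ... | no _ = refl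

  -- Sums and products over the field

  module Σ = Algebra.Properties.CommutativeMonoid.Sum (CommutativeRing.+-commutativeMonoid commutativeRing)
  module Π = Algebra.Properties.CommutativeMonoid.Sum (CommutativeRing.*-commutativeMonoid commutativeRing)

  ∑-const : ∀ n c → Σ.sum {n} (λ _ → c) ≡ fromℕ n * c
  ∑-const zero c = sym (zeroˡ c)
  ∑-const (suc n) c = begin
    c + Σ.sum {n} (λ _ → c)     ≡⟨ cong₂ _+_ (sym (*-identityˡ c)) (∑-const n c) ⟩
    1# * c + fromℕ n * c        ≡⟨ sym (distribʳ c 1# (fromℕ n)) ⟩
    (1# + fromℕ n) * c          ∎

  ∏-const : ∀ n c → Π.sum {n} (λ _ → c) ≡ c ^ n
  ∏-const zero c = refl
  ∏-const (suc n) c = cong (c *_) (∏-const n c)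

  ∏≢0 : ∀ {n} (t : Fin n → Carrier) → (∀ j → t j ≢ 0#) → Π.sum t ≢ 0#
  ∏≢0 {zero} t t≢0 = 1#≢0#
  ∏≢0 {suc n} t t≢0 = x*y≢0 (t≢0 Fin.zero) (∏≢0 (λ j → t (Fin.suc j)) (λ j → t≢0 (Fin.suc j)))

  ∑F : (Carrier → Carrier) → Carrier
  ∑F g = Σ.sum (λ i → g (fromFin i))

  ∏F : (Carrier → Carrier) → Carrier
  ∏F g = Π.sum (λ i → g (fromFin i))

  ∏F-cong : ∀ {g g′} → (∀ y → g y ≡ g′ y) → ∏F g ≡ ∏F g′
  ∏F-cong {g} {g′} eq = Π.sum-cong-≗ {N} {λ i → g (fromFin i)} {λ i → g′ (fromFin i)} (λ i → eq (fromFin i))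

  ∏F-distrib : ∀ g g′ → ∏F (λ y → g y * g′ y) ≡ ∏F g * ∏F g′
  ∏F-distrib g g′ = Π.∑-distrib-+ (λ i → g (fromFin i)) (λ i → g′ (fromFin i))

  module _ {σ τ : Carrier → Carrier} (στ : ∀ x → σ (τ x) ≡ x) (τσ : ∀ x → τ (σ x) ≡ x) where
    private
      π : Permutation N N
      π = permutation (λ i → toFin (σ (fromFin i))) (λ i → toFin (τ (fromFin i)))
        (λ i → trans (cong (λ u → toFin (σ u)) (fromFin-toFin _)) (trans (cong toFin (στ (fromFin i))) (toFin-fromFin i)))
        (λ i → trans (cong (λ u → toFin (τ u)) (fromFin-toFin _)) (trans (cong toFin (τσ (fromFin i))) (toFin-fromFin i)))

    ∑F-reindex : ∀ g → ∑F g ≡ ∑F (λ x → g (σ x))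
    ∑F-reindex g = trans (Σ.sum-permute (λ i → g (fromFin i)) π)
      (Σ.sum-cong-≗ {N} {λ i → g (fromFin (toFin (σ (fromFin i))))} {λ i → g (σ (fromFin i))} (λ i → cong g (fromFin-toFin _)))

    ∏F-reindex : ∀ g → ∏F g ≡ ∏F (λ x → g (σ x))
    ∏F-reindex g = trans (Π.sum-permute (λ i → g (fromFin i)) π) (∏F-cong {λ y → g (fromFin (toFin (σ y)))} (λ y → cong g (fromFin-toFin _)))

  ∏F-point : ∀ x u → ∏F (λ y → if y ≟ᵇ x then u else 1#) ≡ u
  ∏F-point x u = begin
    ∏F (λ y → if y ≟ᵇ x then u else 1#)                ≡⟨ sum-single (CommutativeRing.*-commutativeMonoid commutativeRing) _ (toFin x) others ⟩
    (if fromFin (toFin x) ≟ᵇ x then u else 1#)          ≡⟨ cong (λ y → if y ≟ᵇ x then u else 1#) (fromFin-toFin x) ⟩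
    (if x ≟ᵇ x then u else 1#)                          ≡⟨ cong (if_then u else 1#) (≟ᵇ-refl x) ⟩
    u                                                  ∎
    where
    others : ∀ j → j ≢ toFin x → (if fromFin j ≟ᵇ x then u else 1#) ≡ 1#
    others j j≢x = cong (if_then u else 1#) (≟ᵇ-≢ (λ e → j≢x (trans (sym (toFin-fromFin j)) (cong toFin e))))

  0<N : 0 ℕ.< N
  0<N = ℕₚ.n≢0⇒n>0 (λ N≡0 → Fin0-empty (subst Fin N≡0 (toFin 0#)))
    where
    Fin0-empty : Fin 0 → ⊥
    Fin0-empty ()

  -- Translation by 1# permutes the field, so ∑ x = ∑ (x + 1) = ∑ x + N.
  fromℕ-N≡0 : fromℕ N ≡ 0#
  fromℕ-N≡0 = begin
      fromℕ N                              ≡⟨ sym (*-identityʳ (fromℕ N)) ⟩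
      fromℕ N * 1#                         ≡⟨ sym (∑-const N 1#) ⟩
      Σ.sum {N} (λ _ → 1#)                 ≡⟨ sym ([x+y]-y≡x _ (∑F id)) ⟩
      (Σ.sum {N} (λ _ → 1#) + ∑F id) - ∑F id ≡⟨ cong (_- ∑F id) (trans (+-comm _ _) translate) ⟩
      ∑F id - ∑F id                        ≡⟨ -‿inverseʳ _ ⟩
      0#                                   ∎
    where
    translate : ∑F id + Σ.sum {N} (λ _ → 1#) ≡ ∑F id
    translate = trans (sym (Σ.∑-distrib-+ fromFin (λ _ → 1#)))
      (sym (∑F-reindex {λ x → x + 1#} {λ x → x - 1#}
        (λ x → trans (+-assoc x (- 1#) 1#) (trans (cong (x +_) (-‿inverseˡ 1#)) (+-identityʳ x)))
        (λ x → [x+y]-y≡x x 1#) id))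

  atZero : Carrier → Carrier → Carrier → Carrier
  atZero u w y = if y ≟ᵇ 0# then u else w

  -- Multiplication by x ≢ 0 permutes the nonzero elements and so fixes their product: x ^ (N - 1) = 1.
  ∏F-x-off-0≡1 : ∀ {x} → x ≢ 0# → ∏F (atZero 1# x) ≡ 1#
  ∏F-x-off-0≡1 {x} x≢0 = *-cancelˡ (∏≢0 _ (λ j → nonzero≢0 (fromFin j))) (begin
      ∏F nonzero * ∏F (atZero 1# x)            ≡⟨ *-comm _ _ ⟩
      ∏F (atZero 1# x) * ∏F nonzero            ≡⟨ sym (∏F-distrib (atZero 1# x) nonzero) ⟩
      ∏F (λ y → atZero 1# x y * nonzero y)     ≡⟨ ∏F-cong (λ y → sym (nonzero-scale y)) ⟩
      ∏F (λ y → nonzero (x * y))               ≡⟨ sym (∏F-reindex {λ y → x * y} {λ y → x ⁻¹ * y} x*-x⁻¹* x⁻¹*-x* nonzero) ⟩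
      ∏F nonzero                               ≡⟨ sym (*-identityʳ _) ⟩
      ∏F nonzero * 1#                          ∎)
    where
    nonzero : Carrier → Carrier
    nonzero y = atZero 1# y y
    nonzero≢0 : ∀ y → nonzero y ≢ 0#
    nonzero≢0 y with y ≟ 0#
    ... | yes _ = 1#≢0#
    ... | no y≢0 = y≢0
    nonzero-scale : ∀ y → nonzero (x * y) ≡ atZero 1# x y * nonzero y
    nonzero-scale y with y ≟ 0# | (x * y) ≟ 0#
    ... | yes _ | yes _ = sym (*-identityˡ 1#)
    ... | yes refl | no xy≢0 = ⊥-elim (xy≢0 (zeroʳ x))
    ... | no y≢0 | yes xy≡0 = ⊥-elim (x*y≢0 x≢0 y≢0 xy≡0)
    ... | no _ | no _ = refl
    x*-x⁻¹* : ∀ y → x * (x ⁻¹ * y) ≡ y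
    x*-x⁻¹* y = trans (sym (*-assoc x (x ⁻¹) y)) (trans (cong (_* y) (inverseʳ x x≢0)) (*-identityˡ y))
    x⁻¹*-x* : ∀ y → x ⁻¹ * (x * y) ≡ y
    x⁻¹*-x* y = trans (sym (*-assoc (x ⁻¹) x y)) (trans (cong (_* y) (inverseˡ x x≢0)) (*-identityˡ y))

  x^N≡x : ∀ x → x ^ N ≡ x
  x^N≡x x with x ≟ 0#
  ... | yes refl = 0^n≡0 0<N
  ... | no x≢0 = begin
      x ^ N                                       ≡⟨ sym (∏-const N x) ⟩
      ∏F (λ _ → x)                                ≡⟨ ∏F-cong split ⟩
      ∏F (λ y → atZero 1# x y * atZero x 1# y)    ≡⟨ ∏F-distrib (atZero 1# x) (atZero x 1#) ⟩
      ∏F (atZero 1# x) * ∏F (atZero x 1#)         ≡⟨ cong₂ _*_ (∏F-x-off-0≡1 x≢0) (∏F-point 0# x) ⟩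
      1# * x                                      ≡⟨ *-identityˡ x ⟩
      x                                           ∎
    where
    split : ∀ y → x ≡ atZero 1# x y * atZero x 1# y
    split y with y ≟ 0#
    ... | yes _ = sym (*-identityˡ x)
    ... | no _ = sym (*-identityʳ x)

  -- Counting and multiplying subsets of the field

  countFin : ∀ {n} → (Fin n → Bool) → ℕ
  countFin {zero} f = 0
  countFin {suc n} f = (if f Fin.zero then 1 else 0) ℕ.+ countFin (λ j → f (Fin.suc j))

  countFin-cong : ∀ {n} {f g : Fin n → Bool} → (∀ j → f j ≡ g j) → countFin f ≡ countFin g
  countFin-cong {zero} f≡g = refl
  countFin-cong {suc n} f≡g =
    cong₂ ℕ._+_ (cong (if_then 1 else 0) (f≡g Fin.zero)) (countFin-cong (λ j → f≡g (Fin.suc j)))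

  countFin-drop : ∀ {n} {f g : Fin n → Bool} i → f i ≡ true → g i ≡ false → (∀ j → j ≢ i → f j ≡ g j) →
                  countFin f ≡ suc (countFin g)
  countFin-drop {suc n} {f} {g} Fin.zero fi gi f≡g rewrite fi | gi =
    cong suc (countFin-cong (λ j → f≡g (Fin.suc j) (λ ())))
  countFin-drop {suc n} {f} {g} (Fin.suc i) fi gi f≡g = begin
    f₀ ℕ.+ countFin (λ j → f (Fin.suc j))      ≡⟨ cong₂ ℕ._+_ (cong (if_then 1 else 0) (f≡g Fin.zero (λ ())))
                                                    (countFin-drop i fi gi (λ j j≢i → f≡g (Fin.suc j) (λ e → j≢i (Fin.suc-injective e)))) ⟩
    g₀ ℕ.+ suc (countFin (λ j → g (Fin.suc j))) ≡⟨ ℕₚ.+-suc g₀ _ ⟩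
    suc (g₀ ℕ.+ countFin (λ j → g (Fin.suc j))) ∎
    where
    f₀ g₀ : ℕ
    f₀ = if f Fin.zero then 1 else 0
    g₀ = if g Fin.zero then 1 else 0

  countFin≡0 : ∀ {n} (f : Fin n → Bool) → countFin f ≡ 0 → ∀ j → f j ≡ false
  countFin≡0 {suc n} f e Fin.zero with f Fin.zero
  ... | false = refl
  countFin≡0 {suc n} f e (Fin.suc j) with f Fin.zero
  ... | false = countFin≡0 _ e j

  countFin-true : ∀ n → countFin {n} (λ _ → true) ≡ n
  countFin-true zero = refl
  countFin-true (suc n) = cong suc (countFin-true n)

  countFin≡suc : ∀ {n} (f : Fin n → Bool) {k} → countFin f ≡ suc k → ∃ λ j → f j ≡ true
  countFin≡suc {suc n} f e with f Fin.zero in f₀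
  ... | true = Fin.zero , f₀
  ... | false with countFin≡suc _ e
  ...   | j , fj = Fin.suc j , fj

  Subset : Set
  Subset = Carrier → Bool

  count : Subset → ℕ
  count S = countFin (λ i → S (fromFin i))

  ∏S : Subset → Carrier
  ∏S S = ∏F (λ y → if S y then y else 1#)

  infixl 6 _∖_
  _∖_ : Subset → Carrier → Subset
  (S ∖ x) y = if y ≟ᵇ x then false else S y

  ∖-intro : ∀ {S x y} → S y ≡ true → y ≢ x → (S ∖ x) y ≡ true
  ∖-intro {S} {x} {y} Sy y≢x rewrite ≟ᵇ-≢ y≢x = Sy

  ∖-elim : ∀ {S x y} → (S ∖ x) y ≡ true → S y ≡ true × y ≢ x
  ∖-elim {S} {x} {y} e with y ≟ x
  ... | no y≢x = e , y≢x

  ∖-self : ∀ S x → (S ∖ x) x ≡ false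
  ∖-self S x rewrite ≟ᵇ-refl x = refl

  count-∖ : ∀ S {x} → S x ≡ true → count S ≡ suc (count (S ∖ x))
  count-∖ S {x} Sx = countFin-drop (toFin x)
    (trans (cong S (fromFin-toFin x)) Sx)
    (trans (cong (S ∖ x) (fromFin-toFin x)) (∖-self S x))
    (λ j j≢x → cong (if_then false else S (fromFin j)) (sym (≟ᵇ-≢ (λ e → j≢x (trans (sym (toFin-fromFin j)) (cong toFin e))))))

  ∏S-∖ : ∀ S {x} → S x ≡ true → ∏S S ≡ x * ∏S (S ∖ x)
  ∏S-∖ S {x} Sx = begin
      ∏S S                                              ≡⟨ ∏F-cong split ⟩
      ∏F (λ y → at-x y * (if (S ∖ x) y then y else 1#)) ≡⟨ ∏F-distrib at-x (λ y → if (S ∖ x) y then y else 1#) ⟩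
      ∏F at-x * ∏S (S ∖ x)                              ≡⟨ cong (_* ∏S (S ∖ x)) (∏F-point x x) ⟩
      x * ∏S (S ∖ x)                                    ∎
    where
    at-x : Carrier → Carrier
    at-x y = if y ≟ᵇ x then x else 1#
    split : ∀ y → (if S y then y else 1#) ≡ at-x y * (if (S ∖ x) y then y else 1#)
    split y with y ≟ x
    ... | yes refl rewrite Sx = sym (*-identityʳ y)
    ... | no _ with S y
    ...   | true = sym (*-identityˡ y)
    ...   | false = sym (*-identityˡ 1#)

  ∏S-empty : ∀ S → count S ≡ 0 → ∏S S ≡ 1#
  ∏S-empty S e = sum-ε (CommutativeRing.*-commutativeMonoid commutativeRing) _
    (λ j → cong (if_then fromFin j else 1#) (countFin≡0 _ e j))

  -- The elements of a set closed under a fixed-point-free involution σ fall into pairs {x , σ x}.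
  module _ (σ : Carrier → Carrier) (σ-involutive : ∀ x → σ (σ x) ≡ x) (c : Carrier) where

    Closed Free : Subset → Set
    Closed S = ∀ x → S x ≡ true → S (σ x) ≡ true
    Free S = ∀ x → S x ≡ true → σ x ≢ x

    count≢1 : ∀ S → Closed S → Free S → count S ≢ 1
    count≢1 S closed free e with countFin≡suc _ e
    ... | i , Sx = true≢false (begin
        true                         ≡⟨ sym (∖-intro {S} (closed x Sx) (free x Sx)) ⟩
        (S ∖ x) (σ x)                ≡⟨ cong (S ∖ x) (sym (fromFin-toFin (σ x))) ⟩
        (S ∖ x) (fromFin (toFin (σ x))) ≡⟨ countFin≡0 _ (ℕₚ.suc-injective (trans (sym (count-∖ S Sx)) e)) (toFin (σ x)) ⟩
        false                        ∎)
      where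
      x : Carrier
      x = fromFin i
      true≢false : true ≢ false
      true≢false ()

    ∏S-pairs : ∀ k S → count S ≡ k → Closed S → Free S → (∀ x → S x ≡ true → x * σ x ≡ c) →
               ∃ λ m → m ℕ.+ m ≡ k × ∏S S ≡ c ^ m
    ∏S-pairs zero S e _ _ _ = 0 , refl , ∏S-empty S e
    ∏S-pairs (suc zero) S e closed free _ = ⊥-elim (count≢1 S closed free e)
    ∏S-pairs (suc (suc k)) S e closed free pair with countFin≡suc _ e
    ... | i , Sx = suc m , cong suc (trans (ℕₚ.+-suc m m) (cong suc m+m≡k)) , (begin
        ∏S S                       ≡⟨ ∏S-∖ S Sx ⟩
        x * ∏S S₁                  ≡⟨ cong (x *_) (∏S-∖ S₁ S₁σx) ⟩
        x * (σ x * ∏S S₂)          ≡⟨ sym (*-assoc x (σ x) _) ⟩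
        (x * σ x) * ∏S S₂          ≡⟨ cong₂ _*_ (pair x Sx) ∏S₂ ⟩
        c * c ^ m                  ∎)
      where
      x : Carrier
      x = fromFin i
      S₁ S₂ : Subset
      S₁ = S ∖ x
      S₂ = S₁ ∖ σ x
      S₁σx : S₁ (σ x) ≡ true
      S₁σx = ∖-intro {S} (closed x Sx) (free x Sx)
      S₂⊆S : ∀ y → S₂ y ≡ true → S y ≡ true
      S₂⊆S y S₂y = proj₁ (∖-elim {S} (proj₁ (∖-elim {S₁} S₂y)))
      closed₂ : Closed S₂
      closed₂ y S₂y with ∖-elim {S₁} S₂y
      ... | S₁y , y≢σx with ∖-elim {S} S₁y
      ...   | Sy , y≢x = ∖-intro {S₁} (∖-intro {S} (closed y Sy) (λ e → y≢σx (trans (sym (σ-involutive y)) (cong σ e))))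
                           (λ e → y≢x (trans (sym (σ-involutive y)) (trans (cong σ e) (σ-involutive x))))
      pairs₂ : ∃ λ m → m ℕ.+ m ≡ k × ∏S S₂ ≡ c ^ m
      pairs₂ = ∏S-pairs k S₂ (ℕₚ.suc-injective (ℕₚ.suc-injective (trans (sym (trans (count-∖ S Sx) (cong suc (count-∖ S₁ S₁σx)))) e)))
                 closed₂ (λ y S₂y → free y (S₂⊆S y S₂y)) (λ y S₂y → pair y (S₂⊆S y S₂y))
      m : ℕ
      m = proj₁ pairs₂
      m+m≡k : m ℕ.+ m ≡ k
      m+m≡k = proj₁ (proj₂ pairs₂)
      ∏S₂ : ∏S S₂ ≡ c ^ m
      ∏S₂ = proj₂ (proj₂ pairs₂)


  nonzeros : Subset
  nonzeros = (λ _ → true) ∖ 0#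

  N≡1+count-nonzeros : N ≡ suc (count nonzeros)
  N≡1+count-nonzeros = trans (sym (countFin-true N)) (count-∖ (λ _ → true) refl)

  ∈-nonzeros : ∀ {y} → y ≢ 0# → nonzeros y ≡ true
  ∈-nonzeros = ∖-intro refl

  infixl 7 _÷_
  _÷_ : Carrier → Carrier → Carrier
  t ÷ y = if y ≟ᵇ 0# then 0# else t * y ⁻¹

  ÷-≢0 : ∀ {t y} → y ≢ 0# → t ÷ y ≡ t * y ⁻¹
  ÷-≢0 y≢0 rewrite ≟ᵇ-≢ y≢0 = refl

  y*[t÷y]≡t : ∀ {t y} → y ≢ 0# → y * (t ÷ y) ≡ t
  y*[t÷y]≡t {t} {y} y≢0 = begin
    y * (t ÷ y)        ≡⟨ cong (y *_) (÷-≢0 y≢0) ⟩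
    y * (t * y ⁻¹)     ≡⟨ solve 3 (λ y t y⁻¹ → y :* (t :* y⁻¹) := t :* (y :* y⁻¹)) refl y t (y ⁻¹) ⟩
    t * (y * y ⁻¹)     ≡⟨ cong (t *_) (inverseʳ y y≢0) ⟩
    t * 1#             ≡⟨ *-identityʳ t ⟩
    t                  ∎

  t÷y≢0 : ∀ {t y} → t ≢ 0# → y ≢ 0# → t ÷ y ≢ 0#
  t÷y≢0 t≢0 y≢0 e = t≢0 (trans (sym (y*[t÷y]≡t y≢0)) (trans (cong (_ *_) e) (zeroʳ _)))

  t÷0≡0 : ∀ t → t ÷ 0# ≡ 0#
  t÷0≡0 t rewrite ≟ᵇ-refl 0# = refl

  ÷-involutive : ∀ {t} → t ≢ 0# → ∀ y → t ÷ (t ÷ y) ≡ y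
  ÷-involutive {t} t≢0 y = by-cases (y ≟ 0#)
    where
    by-cases : Dec (y ≡ 0#) → t ÷ (t ÷ y) ≡ y
    by-cases (yes y≡0) = trans (cong (λ z → t ÷ (t ÷ z)) y≡0) (trans (cong (t ÷_) (t÷0≡0 t)) (trans (t÷0≡0 t) (sym y≡0)))
    by-cases (no y≢0) = *-cancelˡ (t÷y≢0 t≢0 y≢0)
      (trans (y*[t÷y]≡t (t÷y≢0 t≢0 y≢0)) (sym (trans (*-comm (t ÷ y) y) (y*[t÷y]≡t y≢0))))

  r^n≡-r : ∀ n {t r} → r * r ≡ t → t ^ n ≡ t → (∀ w → w ^ n ≡ w → w * w ≢ t) → r ^ n ≡ - r
  r^n≡-r n {t} {r} r*r≡t t^n≡t no-root with x*y≡0⇒x≡0⊎y≡0 {r ^ n - r} {r ^ n + r} (begin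
      (r ^ n - r) * (r ^ n + r)  ≡⟨ solve 2 (λ x r → (x :- r) :* (x :+ r) := x :* x :- r :* r) refl (r ^ n) r ⟩
      r ^ n * r ^ n - r * r      ≡⟨ cong (_- r * r) (trans (sym (^-distribʳ-* r r n)) (trans (cong (_^ n) r*r≡t) (trans t^n≡t (sym r*r≡t)))) ⟩
      r * r - r * r              ≡⟨ -‿inverseʳ _ ⟩
      0#                         ∎)
  ... | inj₁ r^n-r≡0 = ⊥-elim (no-root r (x-y≡0⇒x≡y r^n-r≡0) r*r≡t)
  ... | inj₂ r^n+r≡0 = -‿unique (trans (+-comm r (r ^ n)) r^n+r≡0)

  module OddCharacteristic (2≢0 : fromℕ 2 ≢ 0#) where

    -1≢1 : - 1# ≢ 1#
    -1≢1 e = 2≢0 (begin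
      1# + (1# + 0#)     ≡⟨ cong (1# +_) (+-identityʳ 1#) ⟩
      1# + 1#            ≡⟨ cong (1# +_) (sym e) ⟩
      1# - 1#            ≡⟨ -‿inverseʳ 1# ⟩
      0#                 ∎)

    y*y≡1⇒y≡±1 : ∀ {y} → y * y ≡ 1# → y ≡ 1# ⊎ y ≡ - 1#
    y*y≡1⇒y≡±1 {y} y*y≡1 with x*y≡0⇒x≡0⊎y≡0 {y - 1#} {y + 1#} (begin
      (y - 1#) * (y + 1#)  ≡⟨ solve 1 (λ y → (y :- κ 1) :* (y :+ κ 1) := y :* y :- κ 1) refl y ⟩
      y * y - 1#           ≡⟨ x≡y⇒x-y≡0 y*y≡1 ⟩
      0#                   ∎)
    ... | inj₁ y-1≡0 = inj₁ (x-y≡0⇒x≡y y-1≡0)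
    ... | inj₂ y+1≡0 = inj₂ (-‿unique (trans (+-comm 1# y) y+1≡0))

    1÷y≡y : ∀ {y} → y * y ≡ 1# → 1# ÷ y ≡ y
    1÷y≡y {y} y*y≡1 = *-cancelˡ y≢0 (trans (y*[t÷y]≡t y≢0) (sym y*y≡1))
      where
      y≢0 : y ≢ 0#
      y≢0 y≡0 = 1#≢0# (trans (sym y*y≡1) (trans (cong (_* y) y≡0) (zeroˡ y)))

    -- Wilson: the nonzero elements other than ±1 pair off with their inverses.
    ∏-nonzeros≡-1 : ∏S nonzeros ≡ - 1#
    ∏-nonzeros≡-1 = begin
        ∏S nonzeros                 ≡⟨ ∏S-∖ nonzeros (∈-nonzeros 1#≢0#) ⟩
        1# * ∏S (nonzeros ∖ 1#)     ≡⟨ *-identityˡ _ ⟩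
        ∏S (nonzeros ∖ 1#)          ≡⟨ ∏S-∖ (nonzeros ∖ 1#) (∖-intro {nonzeros} (∈-nonzeros -1≢0) -1≢1) ⟩
        - 1# * ∏S S                 ≡⟨ cong (- 1# *_) (trans (proj₂ (proj₂ pairs)) (1^n≡1 (proj₁ pairs))) ⟩
        - 1# * 1#                   ≡⟨ *-identityʳ _ ⟩
        - 1#                        ∎
      where
      -1≢0 : - 1# ≢ 0#
      -1≢0 e = 1#≢0# (trans (sym -1*-1≡1) (trans (cong (_* - 1#) e) (zeroˡ _)))
      S : Subset
      S = nonzeros ∖ 1# ∖ - 1#
      ∈S : ∀ {y} → S y ≡ true → y ≢ 0# × y ≢ 1# × y ≢ - 1#
      ∈S {y} Sy with ∖-elim {nonzeros ∖ 1#} Sy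
      ... | S₁y , y≢-1 with ∖-elim {nonzeros} S₁y
      ...   | S₀y , y≢1 = proj₂ (∖-elim {λ _ → true} S₀y) , y≢1 , y≢-1
      closed : ∀ y → S y ≡ true → S (1# ÷ y) ≡ true
      closed y Sy with ∈S Sy
      ... | y≢0 , y≢1 , y≢-1 = ∖-intro {nonzeros ∖ 1#}
        (∖-intro {nonzeros} (∈-nonzeros (t÷y≢0 1#≢0# y≢0)) (not-fixed y≢1 (*-identityˡ 1#)))
        (not-fixed y≢-1 -1*-1≡1)
        where
        not-fixed : ∀ {z} → y ≢ z → z * z ≡ 1# → 1# ÷ y ≢ z
        not-fixed {z} y≢z z*z≡1 1÷y≡z = y≢z (trans (sym (÷-involutive 1#≢0# y)) (trans (cong (1# ÷_) 1÷y≡z) (1÷y≡y z*z≡1)))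
      free : ∀ y → S y ≡ true → 1# ÷ y ≢ y
      free y Sy y⁻¹≡y with ∈S Sy
      ... | y≢0 , y≢1 , y≢-1 with y*y≡1⇒y≡±1 (trans (cong (y *_) (sym y⁻¹≡y)) (y*[t÷y]≡t y≢0))
      ...   | inj₁ y≡1 = y≢1 y≡1
      ...   | inj₂ y≡-1 = y≢-1 y≡-1
      pairs : ∃ λ m → m ℕ.+ m ≡ count S × ∏S S ≡ 1# ^ m
      pairs = ∏S-pairs (1# ÷_) (÷-involutive 1#≢0#) 1# (count S) S refl closed free (λ y Sy → y*[t÷y]≡t (proj₁ (∈S Sy)))

    -- Euler's criterion for nonsquares: t pairs each y with t ÷ y, and Wilson evaluates the product.
    nonsquare^[N-1]/2≡-1 : ∀ {t} → t ≢ 0# → (∀ r → r * r ≢ t) → ∀ m → N ≡ suc (m ℕ.+ m) → t ^ m ≡ - 1#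
    nonsquare^[N-1]/2≡-1 {t} t≢0 nonsquare m N≡1+2m with ∏S-pairs (t ÷_) (÷-involutive t≢0) t (count nonzeros) nonzeros refl
      (λ y ∈y → ∈-nonzeros (t÷y≢0 t≢0 (nonzero ∈y)))
      (λ y ∈y t÷y≡y → nonsquare y (trans (cong (y *_) (sym t÷y≡y)) (y*[t÷y]≡t (nonzero ∈y))))
      (λ y ∈y → y*[t÷y]≡t (nonzero ∈y))
      where
      nonzero : ∀ {y} → nonzeros y ≡ true → y ≢ 0#
      nonzero ∈y = proj₂ (∖-elim {λ _ → true} ∈y)
    ... | m′ , m′+m′≡count , ∏≡t^m′ = begin
      t ^ m            ≡⟨ cong (t ^_) (m+m≡n+n⇒m≡n {m} {m′}
                            (trans (ℕₚ.suc-injective (trans (sym N≡1+2m) N≡1+count-nonzeros)) (sym m′+m′≡count))) ⟩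
      t ^ m′           ≡⟨ sym ∏≡t^m′ ⟩
      ∏S nonzeros      ≡⟨ ∏-nonzeros≡-1 ⟩
      - 1#             ∎

  -- Polynomials

  coeff-addP : ∀ P Q k → coeff (addP P Q) k ≡ coeff P k + coeff Q k
  coeff-addP [] Q k = sym (+-identityˡ _)
  coeff-addP (c ∷ P) [] k = sym (+-identityʳ _)
  coeff-addP (c ∷ P) (d ∷ Q) zero = refl
  coeff-addP (c ∷ P) (d ∷ Q) (suc k) = coeff-addP P Q k

  coeff-scaleP : ∀ c Q k → coeff (scaleP c Q) k ≡ c * coeff Q k
  coeff-scaleP c [] k = sym (zeroʳ c)
  coeff-scaleP c (d ∷ Q) zero = refl
  coeff-scaleP c (d ∷ Q) (suc k) = coeff-scaleP c Q k

  -- convolution g Q k = ∑ᵢ g i * coeff Q (k - i)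
  convolution : (ℕ → Carrier) → Poly → ℕ → Carrier
  convolution g Q zero = g 0 * coeff Q 0
  convolution g Q (suc k) = g 0 * coeff Q (suc k) + convolution (λ i → g (suc i)) Q k

  convolution-0 : ∀ g Q k → (∀ i → g i ≡ 0#) → convolution g Q k ≡ 0#
  convolution-0 g Q zero g≡0 = trans (cong (_* coeff Q 0) (g≡0 0)) (zeroˡ _)
  convolution-0 g Q (suc k) g≡0 =
    trans (cong₂ _+_ (trans (cong (_* coeff Q (suc k)) (g≡0 0)) (zeroˡ _)) (convolution-0 _ Q k (λ i → g≡0 (suc i)))) (+-identityˡ 0#)

  coeff-mulP : ∀ D Q k → coeff (mulP D Q) k ≡ convolution (coeff D) Q k
  coeff-mulP [] Q k = sym (convolution-0 _ Q k (λ _ → refl))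
  coeff-mulP (c ∷ D) Q zero = trans (coeff-addP (scaleP c Q) _ 0) (trans (cong (_+ 0#) (coeff-scaleP c Q 0)) (+-identityʳ _))
  coeff-mulP (c ∷ D) Q (suc k) = trans (coeff-addP (scaleP c Q) _ (suc k)) (cong₂ _+_ (coeff-scaleP c Q (suc k)) (coeff-mulP D Q k))

  coeff-beyond : ∀ Q k → length Q ℕ.≤ k → coeff Q k ≡ 0#
  coeff-beyond [] k _ = refl
  coeff-beyond (c ∷ Q) (suc k) (ℕ.s≤s le) = coeff-beyond Q k le

  module _ (D : Poly) (deg-D : HasDegree D 2) (Q : Poly) where
    private
      d₀ d₁ d₂ : Carrier
      d₀ = coeff D 0
      d₁ = coeff D 1
      d₂ = coeff D 2
      q : ℕ → Carrier
      q = coeff Q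

    coeff-quadratic*Q : ∀ j → coeff (mulP D Q) (2 ℕ.+ j) ≡ d₀ * q (2 ℕ.+ j) + (d₁ * q (1 ℕ.+ j) + d₂ * q j)
    coeff-quadratic*Q j = trans (coeff-mulP D Q (2 ℕ.+ j)) (cong (λ z → d₀ * q (2 ℕ.+ j) + (d₁ * q (1 ℕ.+ j) + z)) (top j))
      where
      top : ∀ j → convolution (λ i → coeff D (2 ℕ.+ i)) Q j ≡ d₂ * q j
      top zero = refl
      top (suc j) = trans (cong (d₂ * q (suc j) +_) (convolution-0 _ Q j (λ i → proj₂ deg-D (3 ℕ.+ i) (ℕ.s≤s (ℕ.s≤s (ℕ.s≤s ℕ.z≤n))))))
                      (+-identityʳ _)

    -- Downwards from the length of Q, the top coefficients of D * Q force those of Q to vanish.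
    quadratic*Q-of-degree≤3 : (∀ j → coeff (mulP D Q) (4 ℕ.+ j) ≡ 0#) → ∀ j → q (2 ℕ.+ j) ≡ 0#
    quadratic*Q-of-degree≤3 high≡0 j = proj₁ (vanish (length Q) j (ℕₚ.m≤n+m (length Q) j))
      where
      vanish : ∀ m j → length Q ℕ.≤ j ℕ.+ m → q (2 ℕ.+ j) ≡ 0# × q (3 ℕ.+ j) ≡ 0#
      vanish zero j le =
        coeff-beyond Q (2 ℕ.+ j) (ℕₚ.≤-trans le (ℕₚ.≤-trans (ℕₚ.≤-reflexive (ℕₚ.+-identityʳ j)) (ℕₚ.m≤n+m j 2))) ,
        coeff-beyond Q (3 ℕ.+ j) (ℕₚ.≤-trans le (ℕₚ.≤-trans (ℕₚ.≤-reflexive (ℕₚ.+-identityʳ j)) (ℕₚ.m≤n+m j 3)))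
      vanish (suc m) j le with vanish m (suc j) (ℕₚ.≤-trans le (ℕₚ.≤-reflexive (ℕₚ.+-suc j m)))
      ... | q₃≡0 , q₄≡0 with x*y≡0⇒x≡0⊎y≡0 {d₂} {q (2 ℕ.+ j)} (begin
          d₂ * q (2 ℕ.+ j)                                            ≡⟨ sym (trans (cong₂ (λ x y → x + (y + d₂ * q (2 ℕ.+ j)))
                                                                              (trans (cong (d₀ *_) q₄≡0) (zeroʳ d₀)) (trans (cong (d₁ *_) q₃≡0) (zeroʳ d₁)))
                                                                              (trans (+-identityˡ _) (+-identityˡ _))) ⟩
          d₀ * q (4 ℕ.+ j) + (d₁ * q (3 ℕ.+ j) + d₂ * q (2 ℕ.+ j))    ≡⟨ sym (coeff-quadratic*Q (2 ℕ.+ j)) ⟩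
          coeff (mulP D Q) (4 ℕ.+ j)                                  ≡⟨ high≡0 j ⟩
          0#                                                          ∎)
      ...   | inj₁ d₂≡0 = ⊥-elim (proj₁ deg-D d₂≡0)
      ...   | inj₂ q₂≡0 = q₂≡0 , q₃≡0

  -- Comparing coefficients in D * Q ≈ ℓ₀ + ℓ₁ X + ℓ₂ X² + ℓ₃ X³ with D quadratic, so Q linear.
  quadratic*Q≈cubic : ∀ {D Q ℓ₀ ℓ₁ ℓ₂ ℓ₃} → HasDegree D 2 → mulP D Q ≈P (ℓ₀ ∷ ℓ₁ ∷ ℓ₂ ∷ ℓ₃ ∷ []) →
    coeff D 0 * coeff Q 0 ≡ ℓ₀ × coeff D 0 * coeff Q 1 + coeff D 1 * coeff Q 0 ≡ ℓ₁ ×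
    coeff D 1 * coeff Q 1 + coeff D 2 * coeff Q 0 ≡ ℓ₂ × coeff D 2 * coeff Q 1 ≡ ℓ₃
  quadratic*Q≈cubic {D} {Q} deg-D D*Q≈ℓ =
    trans (sym (coeff-mulP D Q 0)) (D*Q≈ℓ 0) ,
    trans (sym (coeff-mulP D Q 1)) (D*Q≈ℓ 1) ,
    trans (sym (trans (coeff-quadratic*Q D deg-D Q 0) (trans (cong (_+ (coeff D 1 * coeff Q 1 + coeff D 2 * coeff Q 0)) (x≡0⇒c*x≡0 q₂≡0)) (+-identityˡ _)))) (D*Q≈ℓ 2) ,
    trans (sym (trans (coeff-quadratic*Q D deg-D Q 1)
                 (trans (cong₂ (λ x y → x + (y + coeff D 2 * coeff Q 1)) (x≡0⇒c*x≡0 q₃≡0) (x≡0⇒c*x≡0 q₂≡0)) (trans (+-identityˡ _) (+-identityˡ _))))) (D*Q≈ℓ 3)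
    where
    q₂≡0 : coeff Q 2 ≡ 0#
    q₂≡0 = quadratic*Q-of-degree≤3 D deg-D Q (λ j → D*Q≈ℓ (4 ℕ.+ j)) 0
    q₃≡0 : coeff Q 3 ≡ 0#
    q₃≡0 = quadratic*Q-of-degree≤3 D deg-D Q (λ j → D*Q≈ℓ (4 ℕ.+ j)) 1

  -- An identity x ≡ f z₁ … zₖ with f 0 … 0 ≡ 0 exhibits x in the ideal generated by the zᵢ.
  in-ideal₁ : ∀ {x} (f : Carrier → Carrier) {z₁} → x ≡ f z₁ → z₁ ≡ 0# → f 0# ≡ 0# → x ≡ 0#
  in-ideal₁ f x≡f refl f0≡0 = trans x≡f f0≡0

  in-ideal₂ : ∀ {x} (f : Carrier → Carrier → Carrier) {z₁ z₂} → x ≡ f z₁ z₂ → z₁ ≡ 0# → z₂ ≡ 0# → f 0# 0# ≡ 0# → x ≡ 0#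
  in-ideal₂ f x≡f refl refl f0≡0 = trans x≡f f0≡0

  in-ideal₃ : ∀ {x} (f : Carrier → Carrier → Carrier → Carrier) {z₁ z₂ z₃} → x ≡ f z₁ z₂ z₃ →
              z₁ ≡ 0# → z₂ ≡ 0# → z₃ ≡ 0# → f 0# 0# 0# ≡ 0# → x ≡ 0#
  in-ideal₃ f x≡f refl refl refl f0≡0 = trans x≡f f0≡0

  in-ideal₄ : ∀ {x} (f : Carrier → Carrier → Carrier → Carrier → Carrier) {z₁ z₂ z₃ z₄} → x ≡ f z₁ z₂ z₃ z₄ →
              z₁ ≡ 0# → z₂ ≡ 0# → z₃ ≡ 0# → z₄ ≡ 0# → f 0# 0# 0# 0# ≡ 0# → x ≡ 0#
  in-ideal₄ f x≡f refl refl refl refl f0≡0 = trans x≡f f0≡0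

  -- (d₀ + d₁ X + d₂ X²) (e₀ + e₁ X) = α + X + β X³ with α = d₀ e₀, β = d₂ e₁, and
  -- (d₀ + d₁ X + d₂ X²) (g₀ + g₁ X) = γ + X² + δ X³ with γ = d₀ g₀, δ = d₂ g₁.
  module CommonQuadraticFactor (d₀ d₁ d₂ e₀ e₁ g₀ g₁ : Carrier) (d₂≢0 : d₂ ≢ 0#)
    (E₁ : d₀ * e₁ + d₁ * e₀ ≡ 1#) (E₂ : d₁ * e₁ + d₂ * e₀ ≡ 0#)
    (G₁ : d₀ * g₁ + d₁ * g₀ ≡ 0#) (G₂ : d₁ * g₁ + d₂ * g₀ ≡ 1#) where

    d₁e₁+d₂g₁≡0 : d₁ * e₁ + d₂ * g₁ ≡ 0#
    d₁e₁+d₂g₁≡0 = in-ideal₄ (λ z₁ z₂ z₃ z₄ → e₁ * (d₂ * z₃ - d₁ * z₄) - g₁ * (d₂ * z₁ - d₁ * z₂))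
      (solve 7 (λ d₀ d₁ d₂ e₀ e₁ g₀ g₁ → d₁ :* e₁ :+ d₂ :* g₁ :=
         e₁ :* (d₂ :* (d₀ :* g₁ :+ d₁ :* g₀) :- d₁ :* (d₁ :* g₁ :+ d₂ :* g₀ :- κ 1))
         :- g₁ :* (d₂ :* (d₀ :* e₁ :+ d₁ :* e₀ :- κ 1) :- d₁ :* (d₁ :* e₁ :+ d₂ :* e₀))) refl d₀ d₁ d₂ e₀ e₁ g₀ g₁)
      (x≡y⇒x-y≡0 E₁) E₂ G₁ (x≡y⇒x-y≡0 G₂)
      (solve 4 (λ d₁ d₂ e₁ g₁ → e₁ :* (d₂ :* κ 0 :- d₁ :* κ 0) :- g₁ :* (d₂ :* κ 0 :- d₁ :* κ 0) := κ 0) refl d₁ d₂ e₁ g₁)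

    d₀d₂e₁-d₁²e₁-d₂≡0 : d₀ * d₂ * e₁ - d₁ * d₁ * e₁ - d₂ ≡ 0#
    d₀d₂e₁-d₁²e₁-d₂≡0 = in-ideal₂ (λ z₁ z₂ → d₂ * z₁ - d₁ * z₂)
      (solve 7 (λ d₀ d₁ d₂ e₀ e₁ g₀ g₁ → d₀ :* d₂ :* e₁ :- d₁ :* d₁ :* e₁ :- d₂ :=
          d₂ :* (d₀ :* e₁ :+ d₁ :* e₀ :- κ 1) :- d₁ :* (d₁ :* e₁ :+ d₂ :* e₀)) refl d₀ d₁ d₂ e₀ e₁ g₀ g₁)
      (x≡y⇒x-y≡0 E₁) E₂
      (solve 2 (λ d₁ d₂ → d₂ :* κ 0 :- d₁ :* κ 0 := κ 0) refl d₁ d₂)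

    αβ²≡δ³+δβ : (d₀ * e₀) * ((d₂ * e₁) * (d₂ * e₁)) ≡ (d₂ * g₁) * ((d₂ * g₁) * (d₂ * g₁)) + (d₂ * g₁) * (d₂ * e₁)
    αβ²≡δ³+δβ = x-y≡0⇒x≡y (in-ideal₃ (λ z₁ z₂ z₃ → d₀ * d₂ * e₁ * e₁ * z₁ - (z₂ * z₂ * z₂ - fromℕ′ 3 * z₂ * z₂ * d₁ * e₁ + fromℕ′ 3 * z₂ * d₁ * d₁ * e₁ * e₁) - d₂ * e₁ * z₂ - d₁ * e₁ * e₁ * z₃)
      (solve 7 (λ d₀ d₁ d₂ e₀ e₁ g₀ g₁ →
          (d₀ :* e₀) :* ((d₂ :* e₁) :* (d₂ :* e₁)) :- ((d₂ :* g₁) :* ((d₂ :* g₁) :* (d₂ :* g₁)) :+ (d₂ :* g₁) :* (d₂ :* e₁)) :=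
          d₀ :* d₂ :* e₁ :* e₁ :* (d₁ :* e₁ :+ d₂ :* e₀)
          :- ((d₁ :* e₁ :+ d₂ :* g₁) :* (d₁ :* e₁ :+ d₂ :* g₁) :* (d₁ :* e₁ :+ d₂ :* g₁)
             :- κ 3 :* (d₁ :* e₁ :+ d₂ :* g₁) :* (d₁ :* e₁ :+ d₂ :* g₁) :* d₁ :* e₁
             :+ κ 3 :* (d₁ :* e₁ :+ d₂ :* g₁) :* d₁ :* d₁ :* e₁ :* e₁)
          :- d₂ :* e₁ :* (d₁ :* e₁ :+ d₂ :* g₁)
          :- d₁ :* e₁ :* e₁ :* (d₀ :* d₂ :* e₁ :- d₁ :* d₁ :* e₁ :- d₂)) refl d₀ d₁ d₂ e₀ e₁ g₀ g₁)
      E₂ d₁e₁+d₂g₁≡0 d₀d₂e₁-d₁²e₁-d₂≡0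
      (solve 4 (λ d₀ d₁ d₂ e₁ → d₀ :* d₂ :* e₁ :* e₁ :* κ 0 :- (κ 0 :* κ 0 :* κ 0 :- κ 3 :* κ 0 :* κ 0 :* d₁ :* e₁ :+ κ 3 :* κ 0 :* d₁ :* d₁ :* e₁ :* e₁) :- d₂ :* e₁ :* κ 0 :- d₁ :* e₁ :* e₁ :* κ 0 := κ 0) refl d₀ d₁ d₂ e₁))

    γδ²≡βα² : (d₀ * g₀) * ((d₂ * g₁) * (d₂ * g₁)) ≡ (d₂ * e₁) * ((d₀ * e₀) * (d₀ * e₀))
    γδ²≡βα² = x-y≡0⇒x≡y (*-cancelˡ (x*y≢0 d₂≢0 d₂≢0) (trans d₂²[γδ²-βα²]≡0 (sym (zeroʳ _))))
      where
      d₂²[γδ²-βα²]≡0 : (d₂ * d₂) * ((d₀ * g₀) * ((d₂ * g₁) * (d₂ * g₁)) - (d₂ * e₁) * ((d₀ * e₀) * (d₀ * e₀))) ≡ 0#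
      d₂²[γδ²-βα²]≡0 = in-ideal₄ (λ z₁ z₂ z₃ z₄ → d₀ * ((d₂ * (z₃ - z₁) - d₁ * (z₄ - z₂)) * (d₂ * g₁) * (d₂ * g₁) + d₂ * d₀ * e₁ * ((z₄ * z₄ - fromℕ′ 2 * d₁ * e₁ * z₄) - (z₂ * z₂ - fromℕ′ 2 * d₁ * e₁ * z₂))))
        (solve 7 (λ d₀ d₁ d₂ e₀ e₁ g₀ g₁ →
          (d₂ :* d₂) :* ((d₀ :* g₀) :* ((d₂ :* g₁) :* (d₂ :* g₁)) :- (d₂ :* e₁) :* ((d₀ :* e₀) :* (d₀ :* e₀))) :=
          d₀ :* ((d₂ :* ((d₁ :* g₁ :+ d₂ :* g₀ :- κ 1) :- (d₀ :* e₁ :+ d₁ :* e₀ :- κ 1)) :- d₁ :* ((d₁ :* e₁ :+ d₂ :* g₁) :- (d₁ :* e₁ :+ d₂ :* e₀))) :* (d₂ :* g₁) :* (d₂ :* g₁)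
            :+ d₂ :* d₀ :* e₁ :* (((d₁ :* e₁ :+ d₂ :* g₁) :* (d₁ :* e₁ :+ d₂ :* g₁) :- κ 2 :* d₁ :* e₁ :* (d₁ :* e₁ :+ d₂ :* g₁))
                             :- ((d₁ :* e₁ :+ d₂ :* e₀) :* (d₁ :* e₁ :+ d₂ :* e₀) :- κ 2 :* d₁ :* e₁ :* (d₁ :* e₁ :+ d₂ :* e₀))))) refl d₀ d₁ d₂ e₀ e₁ g₀ g₁)
        (x≡y⇒x-y≡0 E₁) E₂ (x≡y⇒x-y≡0 G₂) d₁e₁+d₂g₁≡0
        (solve 5 (λ d₀ d₁ d₂ e₁ g₁ → d₀ :* ((d₂ :* (κ 0 :- κ 0) :- d₁ :* (κ 0 :- κ 0)) :* (d₂ :* g₁) :* (d₂ :* g₁) :+ d₂ :* d₀ :* e₁ :* ((κ 0 :* κ 0 :- κ 2 :* d₁ :* e₁ :* κ 0) :- (κ 0 :* κ 0 :- κ 2 :* d₁ :* e₁ :* κ 0))) := κ 0) refl d₀ d₁ d₂ e₁ g₁)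

  common-quadratic-factor : ∀ D {α β γ δ} → HasDegree D 2 →
    D ∣P (α ∷ 1# ∷ 0# ∷ β ∷ []) → D ∣P (γ ∷ 0# ∷ 1# ∷ δ ∷ []) →
    α * (β * β) ≡ δ * (δ * δ) + δ * β × γ * (δ * δ) ≡ β * (α * α)
  common-quadratic-factor D deg-D (E , D*E≈) (G , D*G≈)
    with quadratic*Q≈cubic {D} {E} deg-D D*E≈ | quadratic*Q≈cubic {D} {G} deg-D D*G≈
  ... | refl , E₁ , E₂ , refl | refl , G₁ , G₂ , refl = αβ²≡δ³+δβ , γδ²≡βα²
    where
    open CommonQuadraticFactor (coeff D 0) (coeff D 1) (coeff D 2) (coeff E 0) (coeff E 1) (coeff G 0) (coeff G 1)
      (proj₁ deg-D) E₁ E₂ G₁ G₂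

  -- With y = x ^ (q - 1), f_{a,b}(x) = x (1 + a y ^ q + b y²), and y ^ q = y⁻¹.
  fab≡0 : ∀ {q a b x y} → 0 ℕ.< q → x ≢ 0# → x ^ q ≡ y * x → y ^ q * y ≡ 1# → b * (y * (y * y)) + y + a ≡ 0# →
          fab q a b x ≡ 0#
  fab≡0 {suc q′} {a} {b} {x} {y} _ x≢0 x^q≡yx y^q*y≡1 by³+y+a≡0 =
    trans (cong (x *_) (cong₂ (λ α β → 1# + a * α + b * β) x^[q*[q-1]]≡y^q x^[2*[q-1]]≡y²)) (trans (cong (x *_) factor≡0) (zeroʳ x))
    where
    q = suc q′
    x^[q-1]≡y : x ^ q′ ≡ y
    x^[q-1]≡y = *-cancelˡ x≢0 (trans x^q≡yx (*-comm y x))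
    x^[q*[q-1]]≡y^q : x ^ (q ℕ.* (q ℕ.∸ 1)) ≡ y ^ q
    x^[q*[q-1]]≡y^q = trans (cong (x ^_) (ℕₚ.*-comm q q′)) (trans (^-*-assoc x q′ q) (cong (_^ q) x^[q-1]≡y))
    x^[2*[q-1]]≡y² : x ^ (2 ℕ.* (q ℕ.∸ 1)) ≡ y * (y * 1#)
    x^[2*[q-1]]≡y² = trans (^-*-assoc x 2 q′) (trans (^-comm x 2 q′) (cong (λ z → z * (z * 1#)) x^[q-1]≡y))
    y≢0 : y ≢ 0#
    y≢0 y≡0 = 1#≢0# (trans (sym y^q*y≡1) (trans (cong (y ^ q *_) y≡0) (zeroʳ _)))
    factor≡0 : 1# + a * y ^ q + b * (y * (y * 1#)) ≡ 0#
    factor≡0 with x*y≡0⇒x≡0⊎y≡0 (begin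
      (1# + a * y ^ q + b * (y * (y * 1#))) * y
        ≡⟨ solve 4 (λ a b y yq → (κ 1 :+ a :* yq :+ b :* (y :* (y :* κ 1))) :* y := b :* (y :* (y :* y)) :+ y :+ a :* (yq :* y)) refl a b y (y ^ q) ⟩
      b * (y * (y * y)) + y + a * (y ^ q * y)   ≡⟨ cong (λ z → b * (y * (y * y)) + y + a * z) y^q*y≡1 ⟩
      b * (y * (y * y)) + y + a * 1#            ≡⟨ cong (b * (y * (y * y)) + y +_) (*-identityʳ a) ⟩
      b * (y * (y * y)) + y + a                 ≡⟨ by³+y+a≡0 ⟩
      0#                                        ∎)
    ... | inj₁ factor≡0 = factor≡0
    ... | inj₂ y≡0 = ⊥-elim (y≢0 y≡0)

  -- Prime characteristic

  module Binomial =
    Algebra.Properties.CommutativeSemiring.Binomial (CommutativeRing.commutativeSemiring commutativeRing)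
  open Algebra.Definitions.RawSemiring (CommutativeSemiring.rawSemiring (CommutativeRing.commutativeSemiring commutativeRing))
    using () renaming (_×_ to _×ₙ_; _^_ to _^ᵐ_)

  ^≡^ᵐ : ∀ x n → x ^ n ≡ x ^ᵐ n
  ^≡^ᵐ x zero = refl
  ^≡^ᵐ x (suc n) = cong (x *_) (^≡^ᵐ x n)

  ×ₙ≡fromℕ* : ∀ m z → m ×ₙ z ≡ fromℕ m * z
  ×ₙ≡fromℕ* zero z = sym (zeroˡ z)
  ×ₙ≡fromℕ* (suc m) z = begin
    z + m ×ₙ z               ≡⟨ cong₂ _+_ (sym (*-identityˡ z)) (×ₙ≡fromℕ* m z) ⟩
    1# * z + fromℕ m * z    ≡⟨ sym (distribʳ z 1# (fromℕ m)) ⟩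
    (1# + fromℕ m) * z      ∎

  1×ₙz≡z : ∀ z → 1 ×ₙ z ≡ z
  1×ₙz≡z z = +-identityʳ z

  fromℕ[k*n]≡0 : ∀ k {n} → fromℕ n ≡ 0# → fromℕ (k ℕ.* n) ≡ 0#
  fromℕ[k*n]≡0 k {n} n≡0 = trans (fromℕ-homo-* k n) (trans (cong (fromℕ k *_) n≡0) (zeroʳ _))

  fromℕ[1+k*n]≡1 : ∀ k {n} → fromℕ n ≡ 0# → fromℕ (suc (k ℕ.* n)) ≡ 1#
  fromℕ[1+k*n]≡1 k n≡0 = trans (cong (1# +_) (fromℕ[k*n]≡0 k n≡0)) (+-identityʳ 1#)

  -- In the binomial expansion of (x + y) ^ p only the two extreme terms survive.
  [x+y]^p≡x^p+y^p : ∀ {p} → Prime p → fromℕ p ≡ 0# → ∀ x y → (x + y) ^ p ≡ x ^ p + y ^ p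
  [x+y]^p≡x^p+y^p {suc p′} p-prime p≡0 x y = begin
      (x + y) ^ p                                         ≡⟨ ^≡^ᵐ (x + y) p ⟩
      (x + y) ^ᵐ p                                        ≡⟨ Binomial.theorem p x y ⟩
      term Fin.zero + Σ.sum (λ j → term (Fin.suc j))
        ≡⟨ cong₂ _+_ first (sum-single (CommutativeRing.+-commutativeMonoid commutativeRing) _ (Fin.fromℕ p′) middle) ⟩
      y ^ p + term (Fin.suc (Fin.fromℕ p′))               ≡⟨ cong (y ^ p +_) last ⟩
      y ^ p + x ^ p                                       ≡⟨ +-comm _ _ ⟩
      x ^ p + y ^ p                                       ∎
    where
    p : ℕ
    p = suc p′
    term : Fin (suc p) → Carrier
    term = Binomial.binomialTerm x y p
    first : term Fin.zero ≡ y ^ p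
    first = trans (1×ₙz≡z _) (trans (*-identityˡ _) (sym (^≡^ᵐ y p)))
    last : term (Fin.suc (Fin.fromℕ p′)) ≡ x ^ p
    last = begin
      (p C Fin.toℕ (Fin.suc (Fin.fromℕ p′))) ×ₙ (x ^ᵐ Fin.toℕ (Fin.suc (Fin.fromℕ p′)) * y ^ᵐ (p ℕ.∸ Fin.toℕ (Fin.suc (Fin.fromℕ p′))))
        ≡⟨ cong (λ k → (p C k) ×ₙ (x ^ᵐ k * y ^ᵐ (p ℕ.∸ k))) (cong suc (Fin.toℕ-fromℕ p′)) ⟩
      (p C p) ×ₙ (x ^ᵐ p * y ^ᵐ (p ℕ.∸ p))
        ≡⟨ cong₂ (λ c k → c ×ₙ (x ^ᵐ p * y ^ᵐ k)) (nCn≡1 p) (ℕₚ.n∸n≡0 p) ⟩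
      1 ×ₙ (x ^ᵐ p * 1#)      ≡⟨ trans (1×ₙz≡z _) (*-identityʳ _) ⟩
      x ^ᵐ p                 ≡⟨ sym (^≡^ᵐ x p) ⟩
      x ^ p                  ∎
    vanishes : ∀ m z → p ∣ m → m ×ₙ z ≡ 0#
    vanishes m z (divides c m≡c*p) = begin
      m ×ₙ z                  ≡⟨ ×ₙ≡fromℕ* m z ⟩
      fromℕ m * z            ≡⟨ cong (λ u → fromℕ u * z) m≡c*p ⟩
      fromℕ (c ℕ.* p) * z    ≡⟨ cong (_* z) (fromℕ[k*n]≡0 c p≡0) ⟩
      0# * z                 ≡⟨ zeroˡ z ⟩
      0#                     ∎
    middle : ∀ j → j ≢ Fin.fromℕ p′ → term (Fin.suc j) ≡ 0#
    middle j j≢p′ = vanishes _ _ (prime∣pC[1+k] p-prime (Fin.toℕ j)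
      (ℕ.s≤s (ℕₚ.≤∧≢⇒< (ℕₚ.≤-pred (Fin.toℕ<n j))
        (λ e → j≢p′ (Fin.toℕ-injective (trans e (sym (Fin.toℕ-fromℕ p′))))))))

  module Characteristic {p : ℕ} (p-prime : Prime p) (p≡0 : fromℕ p ≡ 0#) where

    fromℕ≢0 : ∀ m .{{_ : NonZero m}} → m ℕ.< p → fromℕ m ≢ 0#
    fromℕ≢0 m m<p m≡0 with coprime-Bézout (prime⇒coprime p-prime m<p)
    ... | Bézout.+- k l 1+l*m≡k*p =
      1#≢0# (trans (sym (fromℕ[1+k*n]≡1 l m≡0)) (trans (cong fromℕ 1+l*m≡k*p) (fromℕ[k*n]≡0 k p≡0)))
    ... | Bézout.-+ k l 1+k*p≡l*m =
      1#≢0# (trans (sym (fromℕ[1+k*n]≡1 k p≡0)) (trans (cong fromℕ 1+k*p≡l*m) (fromℕ[k*n]≡0 l m≡0)))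

    module Frobenius (h : ℕ) where
      q : ℕ
      q = p ℕ.^ h

      0<q : 0 ℕ.< q
      0<q = ℕₚ.m^n>0 p {{Prime.prime⇒nonZero p-prime}} h

      [x+y]^p^k≡x^p^k+y^p^k : ∀ k x y → (x + y) ^ (p ℕ.^ k) ≡ x ^ (p ℕ.^ k) + y ^ (p ℕ.^ k)
      [x+y]^p^k≡x^p^k+y^p^k zero x y = trans (*-identityʳ _) (sym (cong₂ _+_ (*-identityʳ x) (*-identityʳ y)))
      [x+y]^p^k≡x^p^k+y^p^k (suc k) x y = begin
        (x + y) ^ (p ℕ.* pᵏ)               ≡⟨ ^-*-assoc (x + y) p pᵏ ⟩
        ((x + y) ^ p) ^ pᵏ                 ≡⟨ cong (_^ pᵏ) ([x+y]^p≡x^p+y^p p-prime p≡0 x y) ⟩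
        (x ^ p + y ^ p) ^ pᵏ               ≡⟨ [x+y]^p^k≡x^p^k+y^p^k k _ _ ⟩
        (x ^ p) ^ pᵏ + (y ^ p) ^ pᵏ        ≡⟨ sym (cong₂ _+_ (^-*-assoc x p pᵏ) (^-*-assoc y p pᵏ)) ⟩
        x ^ (p ℕ.* pᵏ) + y ^ (p ℕ.* pᵏ)    ∎
        where
        pᵏ : ℕ
        pᵏ = p ℕ.^ k

      [x+y]^q≡x^q+y^q : ∀ x y → (x + y) ^ q ≡ x ^ q + y ^ q
      [x+y]^q≡x^q+y^q = [x+y]^p^k≡x^p^k+y^p^k h

      [-x]^q≡-x^q : ∀ x → (- x) ^ q ≡ - (x ^ q)
      [-x]^q≡-x^q x = -‿unique (trans (sym ([x+y]^q≡x^q+y^q x (- x))) (trans (cong (_^ q) (-‿inverseʳ x)) (0^n≡0 0<q)))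

      [x-y]^q≡x^q-y^q : ∀ x y → (x - y) ^ q ≡ x ^ q - y ^ q
      [x-y]^q≡x^q-y^q x y = trans ([x+y]^q≡x^q+y^q x (- y)) (cong (x ^ q +_) ([-x]^q≡-x^q y))

      fromℕ-m^q≡fromℕ-m : ∀ m → fromℕ m ^ q ≡ fromℕ m
      fromℕ-m^q≡fromℕ-m zero = 0^n≡0 0<q
      fromℕ-m^q≡fromℕ-m (suc m) = trans ([x+y]^q≡x^q+y^q 1# (fromℕ m)) (cong₂ _+_ (1^n≡1 q) (fromℕ-m^q≡fromℕ-m m))

      fromℕ′-m^q≡fromℕ′-m : ∀ m → fromℕ′ m ^ q ≡ fromℕ′ m
      fromℕ′-m^q≡fromℕ′-m m = trans (cong (_^ q) (fromℕ′≡fromℕ m)) (trans (fromℕ-m^q≡fromℕ-m m) (sym (fromℕ′≡fromℕ m)))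

      x⁻¹^q≡[x^q]⁻¹ : ∀ {x} → x ≢ 0# → (x ⁻¹) ^ q ≡ (x ^ q) ⁻¹
      x⁻¹^q≡[x^q]⁻¹ {x} x≢0 = ⁻¹-unique (trans (sym (^-distribʳ-* x (x ⁻¹) q)) (trans (cong (_^ q) (inverseʳ x x≢0)) (1^n≡1 q)))

  -- From here on F has q² elements, so x ↦ x ^ q is the conjugation of F over its subfield F_q.
  module QuadraticExtension {p : ℕ} (p-prime : Prime p) (2<p : 2 ℕ.< p) (h : ℕ) (N≡p^2h : N ≡ p ℕ.^ (2 ℕ.* h)) where

    p≡0 : fromℕ p ≡ 0#
    p≡0 = x^n≡0⇒x≡0 (2 ℕ.* h) (trans (sym (fromℕ-homo-^ p (2 ℕ.* h))) (trans (cong fromℕ (sym N≡p^2h)) fromℕ-N≡0))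

    open Characteristic p-prime p≡0 public
    open Frobenius h public

    2≢0 : fromℕ 2 ≢ 0#
    2≢0 = fromℕ≢0 2 2<p

    open OddCharacteristic 2≢0 public

    q*q≡N : q ℕ.* q ≡ N
    q*q≡N = trans (sym (ℕₚ.^-distribˡ-+-* p h h)) (trans (cong (p ℕ.^_) (cong (h ℕ.+_) (sym (ℕₚ.+-identityʳ h)))) (sym N≡p^2h))

    x^q^q≡x : ∀ x → (x ^ q) ^ q ≡ x
    x^q^q≡x x = trans (sym (^-*-assoc x q q)) (trans (cong (x ^_) q*q≡N) (x^N≡x x))

    q-odd : ∃ λ u → q ≡ suc (u ℕ.+ u)
    q-odd with odd-prime p-prime 2<p
    ... | k , p≡1+2k with odd^n-odd k h
    ...   | u , e = u , trans (cong (ℕ._^ h) p≡1+2k) e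

    u : ℕ
    u = proj₁ q-odd
    q≡1+2u : q ≡ suc (u ℕ.+ u)
    q≡1+2u = proj₂ q-odd

    N≡1+2m : N ≡ suc ((u ℕ.+ u) ℕ.* suc u ℕ.+ (u ℕ.+ u) ℕ.* suc u)
    N≡1+2m = trans (sym q*q≡N) (trans (cong₂ ℕ._*_ q≡1+2u q≡1+2u) (square u))
      where
      square : ∀ u → suc (u ℕ.+ u) ℕ.* suc (u ℕ.+ u) ≡ suc ((u ℕ.+ u) ℕ.* suc u ℕ.+ (u ℕ.+ u) ℕ.* suc u)
      square = ℕ-Solver.solve-∀

    t^[q-1]≡1 : ∀ {t} → t ≢ 0# → t ^ q ≡ t → t ^ (u ℕ.+ u) ≡ 1#
    t^[q-1]≡1 {t} t≢0 t^q≡t = *-cancelˡ t≢0 (trans (trans (sym (cong (t ^_) q≡1+2u)) t^q≡t) (sym (*-identityʳ t)))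

    -- Euler's criterion fails for t ∈ F_q, since (N - 1) / 2 is a multiple of q - 1.
    square-root : ∀ {t} → t ^ q ≡ t → ∃ λ r → r * r ≡ t
    square-root {t} t^q≡t with t ≟ 0# | any? (λ r → r * r ≟ t)
    ... | yes t≡0 | _ = 0# , trans (zeroˡ 0#) (sym t≡0)
    ... | no _ | yes root = root
    ... | no t≢0 | no nonsquare = ⊥-elim (-1≢1 (begin
      - 1#                                   ≡⟨ sym (nonsquare^[N-1]/2≡-1 t≢0 (λ r e → nonsquare (r , e)) ((u ℕ.+ u) ℕ.* suc u) N≡1+2m) ⟩
      t ^ ((u ℕ.+ u) ℕ.* suc u)              ≡⟨ ^-*-assoc t (u ℕ.+ u) (suc u) ⟩
      (t ^ (u ℕ.+ u)) ^ suc u                ≡⟨ cong (_^ suc u) (t^[q-1]≡1 t≢0 t^q≡t) ⟩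
      1# ^ suc u                             ≡⟨ 1^n≡1 (suc u) ⟩
      1#                                     ∎))

    -- If every element were in F_q, choosing square roots would give an injection F → F
    -- missing - √1.
    outside-Fq : ∃ λ c → c ^ q ≢ c
    outside-Fq with any? (λ c → ¬? (c ^ q ≟ c))
    ... | yes found = found
    ... | no none = ⊥-elim (w≢0 w≡0)
      where
      in-Fq : ∀ c → c ^ q ≡ c
      in-Fq c with c ^ q ≟ c
      ... | yes c^q≡c = c^q≡c
      ... | no c^q≢c = ⊥-elim (none (c , c^q≢c))
      √ : Carrier → Carrier
      √ c = proj₁ (square-root (in-Fq c))
      √c*√c≡c : ∀ c → √ c * √ c ≡ c
      √c*√c≡c c = proj₂ (square-root (in-Fq c))
      √-injective : ∀ {c d} → √ c ≡ √ d → c ≡ d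
      √-injective {c} {d} e = trans (sym (√c*√c≡c c)) (trans (cong (λ z → z * z) e) (√c*√c≡c d))
      w : Carrier
      w = √ 1#
      w≢0 : w ≢ 0#
      w≢0 w≡0 = 1#≢0# (trans (sym (√c*√c≡c 1#)) (trans (cong (λ z → z * z) w≡0) (zeroˡ 0#)))
      -w-hit : ∃ λ i → toFin (√ (fromFin i)) ≡ toFin (- w)
      -w-hit = injective⇒surjective (λ i → toFin (√ (fromFin i)))
        (λ e → trans (sym (toFin-fromFin _)) (trans (cong toFin (√-injective (toFin-injective e))) (toFin-fromFin _))) (toFin (- w))
      c : Carrier
      c = fromFin (proj₁ -w-hit)
      √c≡-w : √ c ≡ - w
      √c≡-w = toFin-injective (proj₂ -w-hit)
      c≡1 : c ≡ 1#
      c≡1 = begin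
        c              ≡⟨ sym (√c*√c≡c c) ⟩
        √ c * √ c      ≡⟨ cong (λ z → z * z) √c≡-w ⟩
        - w * - w      ≡⟨ solve 1 (λ w → :- w :* :- w := w :* w) refl w ⟩
        w * w          ≡⟨ √c*√c≡c 1# ⟩
        1#             ∎
      w≡0 : w ≡ 0#
      w≡0 with x*y≡0⇒x≡0⊎y≡0 {fromℕ 2} {w} (begin
        fromℕ 2 * w    ≡⟨ solve 1 (λ w → (κ 1 :+ (κ 1 :+ κ 0)) :* w := w :+ w) refl w ⟩
        w + w          ≡⟨ cong (w +_) (trans (cong √ (sym c≡1)) √c≡-w) ⟩
        w - w          ≡⟨ -‿inverseʳ w ⟩
        0#             ∎)
      ... | inj₁ 2≡0 = ⊥-elim (2≢0 2≡0)
      ... | inj₂ w≡0 = w≡0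

    hilbert90 : ∀ {y} → y ^ q * y ≡ 1# → ∃ λ x → x ≢ 0# × x ^ q ≡ y * x
    hilbert90 {y} y^q*y≡1 with y ≟ - 1#
    ... | no y≢-1 = 1# + y ⁻¹ , x≢0 , (begin
        (1# + y ⁻¹) ^ q          ≡⟨ [x+y]^q≡x^q+y^q 1# (y ⁻¹) ⟩
        1# ^ q + (y ⁻¹) ^ q      ≡⟨ cong₂ _+_ (1^n≡1 q) (trans (x⁻¹^q≡[x^q]⁻¹ y≢0) (trans (cong _⁻¹ y^q≡y⁻¹) (⁻¹-involutive y≢0))) ⟩
        1# + y                   ≡⟨ +-comm 1# y ⟩
        y + 1#                   ≡⟨ sym (cong₂ _+_ (*-identityʳ y) (inverseʳ y y≢0)) ⟩
        y * 1# + y * y ⁻¹        ≡⟨ sym (distribˡ y 1# (y ⁻¹)) ⟩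
        y * (1# + y ⁻¹)          ∎)
      where
      y≢0 : y ≢ 0#
      y≢0 y≡0 = 1#≢0# (trans (sym y^q*y≡1) (trans (cong (y ^ q *_) y≡0) (zeroʳ _)))
      y^q≡y⁻¹ : y ^ q ≡ y ⁻¹
      y^q≡y⁻¹ = ⁻¹-unique (trans (*-comm y (y ^ q)) y^q*y≡1)
      x≢0 : 1# + y ⁻¹ ≢ 0#
      x≢0 e = y≢-1 (trans (sym (⁻¹-involutive y≢0)) (trans (cong _⁻¹ (-‿unique e)) (sym (⁻¹-unique -1*-1≡1))))
    ... | yes y≡-1 = c - c ^ q , (λ e → proj₂ outside-Fq (sym (x-y≡0⇒x≡y e))) , (begin
        (c - c ^ q) ^ q          ≡⟨ [x-y]^q≡x^q-y^q c (c ^ q) ⟩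
        c ^ q - (c ^ q) ^ q      ≡⟨ cong (λ z → c ^ q - z) (x^q^q≡x c) ⟩
        c ^ q - c                ≡⟨ solve 2 (λ c d → d :- c := :- κ 1 :* (c :- d)) refl c (c ^ q) ⟩
        - 1# * (c - c ^ q)       ≡⟨ cong (_* (c - c ^ q)) (sym y≡-1) ⟩
        y * (c - c ^ q)          ∎)
      where
      c : Carrier
      c = proj₁ outside-Fq

    module Proposition3p1 {a b : Carrier} (a≢0 : a ≢ 0#) (b≢0 : b ≢ 0#)
      (fab-injective : ∀ {x y} → fab q a b x ≡ fab q a b y → x ≡ y)
      (common-factor : ∃ λ D → HasDegree D 2 × D ∣P (a ∷ 1# ∷ 0# ∷ b ∷ []) × D ∣P (b ^ q ∷ 0# ∷ 1# ∷ a ^ q ∷ [])) where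

      -- T is t written with s and with the constants in the form the ring solver produces.
      A s v t T : Carrier
      A = a ^ q
      s = A * a
      v = b * a ^ 2
      t = - (fromℕ 3 * a ^ (2 ℕ.* q ℕ.+ 2)) - fromℕ 4 * v
      T = - (fromℕ′ 3 * (s * s)) - fromℕ′ 4 * v

      relations : a * (b * b) ≡ A * (A * A) + A * b × b ^ q * (A * A) ≡ b * (a * a)
      relations = let (D , deg-D , D∣first , D∣second) = common-factor
                  in common-quadratic-factor D deg-D D∣first D∣second

      cubic-relation : a * (b * b) ≡ A * (A * A) + A * b
      cubic-relation = proj₁ relations

      norm-relation : b ^ q * (A * A) ≡ b * (a * a)
      norm-relation = proj₂ relations

      a^[q+1]≡s : a ^ (q ℕ.+ 1) ≡ s
      a^[q+1]≡s = trans (^-distribˡ-+-* a q 1) (cong (A *_) (*-identityʳ a))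

      a^[k*[q+1]]≡s^k : ∀ k → a ^ (k ℕ.* q ℕ.+ k) ≡ s ^ k
      a^[k*[q+1]]≡s^k k = trans (cong (a ^_) (k*q+k≡[q+1]*k k q)) (trans (^-*-assoc a (q ℕ.+ 1) k) (cong (_^ k) a^[q+1]≡s))
        where
        k*q+k≡[q+1]*k : ∀ k q → k ℕ.* q ℕ.+ k ≡ (q ℕ.+ 1) ℕ.* k
        k*q+k≡[q+1]*k = ℕ-Solver.solve-∀

      s^q≡s : s ^ q ≡ s
      s^q≡s = trans (^-distribʳ-* A a q) (trans (cong (_* A) (x^q^q≡x a)) (*-comm a A))

      v^q≡v : v ^ q ≡ v
      v^q≡v = begin
        (b * a ^ 2) ^ q       ≡⟨ ^-distribʳ-* b (a ^ 2) q ⟩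
        b ^ q * (a ^ 2) ^ q   ≡⟨ cong (b ^ q *_) (trans (^-comm a 2 q) (cong (A *_) (*-identityʳ A))) ⟩
        b ^ q * (A * A)       ≡⟨ norm-relation ⟩
        b * (a * a)           ≡⟨ cong (λ z → b * (a * z)) (sym (*-identityʳ a)) ⟩
        b * a ^ 2             ∎

      v≢0 : v ≢ 0#
      v≢0 = x*y≢0 b≢0 (x^n≢0 2 a≢0)

      b≡v/a² : b ≡ v * (a ^ 2) ⁻¹
      b≡v/a² = sym (trans (*-assoc b (a ^ 2) _) (trans (cong (b *_) (inverseʳ _ (x^n≢0 2 a≢0))) (*-identityʳ b)))

      -- Multiplying the cubic relation by a³ gives the quadratic for v.
      v²-sv-s³≡0 : v * v - s * v - s * (s * s) ≡ 0#
      v²-sv-s³≡0 = in-ideal₁ (λ z → a * (a * a) * z)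
        (solve 3 (λ a b A → (b :* (a :* (a :* κ 1))) :* (b :* (a :* (a :* κ 1))) :- (A :* a) :* (b :* (a :* (a :* κ 1))) :- (A :* a) :* ((A :* a) :* (A :* a))
                  := a :* (a :* a) :* (a :* (b :* b) :- (A :* (A :* A) :+ A :* b))) refl a b A)
        (x≡y⇒x-y≡0 cubic-relation)
        (zeroʳ _)

      v-quadratic : v * v - a ^ (q ℕ.+ 1) * v - a ^ (3 ℕ.* q ℕ.+ 3) ≡ 0#
      v-quadratic = trans (cong₂ (λ α β → v * v - α * v - β) a^[q+1]≡s a³ᵠ⁺³≡s³) v²-sv-s³≡0
        where
        a³ᵠ⁺³≡s³ : a ^ (3 ℕ.* q ℕ.+ 3) ≡ s * (s * s)
        a³ᵠ⁺³≡s³ = trans (a^[k*[q+1]]≡s^k 3) (cong (λ z → s * (s * z)) (*-identityʳ s))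

      t≡T : t ≡ T
      t≡T = begin
        - (fromℕ 3 * a ^ (2 ℕ.* q ℕ.+ 2)) - fromℕ 4 * v   ≡⟨ cong₂ (λ α β → - (α * β) - fromℕ 4 * v) (sym (fromℕ′≡fromℕ 3)) a²ᵠ⁺²≡s² ⟩
        - (fromℕ′ 3 * (s * s)) - fromℕ 4 * v               ≡⟨ cong (λ α → - (fromℕ′ 3 * (s * s)) - α * v) (sym (fromℕ′≡fromℕ 4)) ⟩
        - (fromℕ′ 3 * (s * s)) - fromℕ′ 4 * v              ∎
        where
        a²ᵠ⁺²≡s² : a ^ (2 ℕ.* q ℕ.+ 2) ≡ s * s
        a²ᵠ⁺²≡s² = trans (a^[k*[q+1]]≡s^k 2) (cong (s *_) (*-identityʳ s))

      t^q≡t : t ^ q ≡ t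
      t^q≡t = trans (cong (_^ q) t≡T) (trans T^q≡T (sym t≡T))
        where
        T^q≡T : T ^ q ≡ T
        T^q≡T = begin
          (- (fromℕ′ 3 * (s * s)) - fromℕ′ 4 * v) ^ q           ≡⟨ [x-y]^q≡x^q-y^q _ _ ⟩
          (- (fromℕ′ 3 * (s * s))) ^ q - (fromℕ′ 4 * v) ^ q     ≡⟨ cong₂ _-_ ([-x]^q≡-x^q _) (^-distribʳ-* _ _ q) ⟩
          - ((fromℕ′ 3 * (s * s)) ^ q) - fromℕ′ 4 ^ q * v ^ q
            ≡⟨ cong₂ (λ α β → - α - β)
                 (trans (^-distribʳ-* _ _ q) (cong₂ _*_ (fromℕ′-m^q≡fromℕ′-m 3) (trans (^-distribʳ-* s s q) (cong₂ _*_ s^q≡s s^q≡s))))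
                 (cong₂ _*_ (fromℕ′-m^q≡fromℕ′-m 4) v^q≡v) ⟩
          - (fromℕ′ 3 * (s * s)) - fromℕ′ 4 * v                 ∎

      -- y = a (s + r) / 2v is a root of b X³ + X + a of norm y ^ (q + 1) = 1, so by Hilbert 90
      -- y = x ^ (q - 1) with x ≢ 0, whence f_{a,b}(x) = 0 = f_{a,b}(0).
      module ConjugateRoot (r : Carrier) (r*r≡t : r * r ≡ t) (r^q≡-r : r ^ q ≡ - r) where

        2v≢0 : fromℕ′ 2 * v ≢ 0#
        2v≢0 = x*y≢0 (λ e → 2≢0 (trans (sym (fromℕ′≡fromℕ 2)) e)) v≢0

        iv y : Carrier
        iv = (fromℕ′ 2 * v) ⁻¹
        y = a * ((s + r) * iv)

        T-root : r * r - T ≡ 0#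
        T-root = x≡y⇒x-y≡0 (trans r*r≡t t≡T)

        v-root : v * v - s * v - s * (s * s) ≡ 0#
        v-root = v²-sv-s³≡0

        inverse : fromℕ′ 2 * v * iv - 1# ≡ 0#
        inverse = x≡y⇒x-y≡0 (inverseʳ _ 2v≢0)

        b-def : b * (a * a) - v ≡ 0#
        b-def = x≡y⇒x-y≡0 (cong (λ z → b * (a * z)) (sym (*-identityʳ a)))

        iv^q≡iv : iv ^ q ≡ iv
        iv^q≡iv = trans (x⁻¹^q≡[x^q]⁻¹ 2v≢0)
          (cong _⁻¹ (trans (^-distribʳ-* (fromℕ′ 2) v q) (cong₂ _*_ (fromℕ′-m^q≡fromℕ′-m 2) v^q≡v)))

        y^q≡A[s-r]/2v : y ^ q ≡ A * ((s - r) * iv)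
        y^q≡A[s-r]/2v = trans (^-distribʳ-* a _ q) (cong (A *_)
          (trans (^-distribʳ-* (s + r) iv q) (cong₂ _*_ (trans ([x+y]^q≡x^q+y^q s r) (cong₂ _+_ s^q≡s r^q≡-r)) iv^q≡iv)))

        y^q*y≡1 : y ^ q * y ≡ 1#
        y^q*y≡1 = x-y≡0⇒x≡y (trans (cong (λ z → z * y - 1#) y^q≡A[s-r]/2v) (in-ideal₃ (λ z₁ z₂ z₃ → - (s * iv * iv) * z₁ - fromℕ′ 4 * iv * iv * z₂ + (fromℕ′ 2 * v * iv + 1#) * z₃)
            (solve 5 (λ a A r v iv →
                (A :* ((A :* a :- r) :* iv)) :* (a :* ((A :* a :+ r) :* iv)) :- κ 1 :=
                :- ((A :* a) :* iv :* iv) :* (r :* r :- (:- (κ 3 :* ((A :* a) :* (A :* a))) :- κ 4 :* v))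
                :- κ 4 :* iv :* iv :* (v :* v :- (A :* a) :* v :- (A :* a) :* ((A :* a) :* (A :* a)))
                :+ (κ 2 :* v :* iv :+ κ 1) :* (κ 2 :* v :* iv :- κ 1)) refl a A r v iv)
            T-root v-root inverse
            (solve 3 (λ s iv v → :- (s :* iv :* iv) :* κ 0 :- κ 4 :* iv :* iv :* κ 0 :+ (κ 2 :* v :* iv :+ κ 1) :* κ 0 := κ 0) refl s iv v)))

        by³+y+a≡0 : b * (y * (y * y)) + y + a ≡ 0#
        by³+y+a≡0 = in-ideal₄ (λ z₁ z₂ z₃ z₄ → a * (iv * iv * iv * (v * (fromℕ′ 3 * s + r) * z₁ + fromℕ′ 8 * v * z₂)
                                       - z₃ * (fromℕ′ 2 * v * iv + 1#) * (s + r) * iv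
                                       - z₃ * ((fromℕ′ 2 * v * iv) * (fromℕ′ 2 * v * iv) + fromℕ′ 2 * v * iv + 1#))
                                  + z₄ * (a * (((s + r) * iv) * (((s + r) * iv) * ((s + r) * iv)))))
            (solve 6 (λ a A r v iv b →
                b :* ((a :* ((A :* a :+ r) :* iv)) :* ((a :* ((A :* a :+ r) :* iv)) :* (a :* ((A :* a :+ r) :* iv)))) :+ a :* ((A :* a :+ r) :* iv) :+ a :=
                a :* (iv :* iv :* iv :* (v :* (κ 3 :* (A :* a) :+ r) :* (r :* r :- (:- (κ 3 :* ((A :* a) :* (A :* a))) :- κ 4 :* v))
                                     :+ κ 8 :* v :* (v :* v :- (A :* a) :* v :- (A :* a) :* ((A :* a) :* (A :* a))))
                     :- (κ 2 :* v :* iv :- κ 1) :* (κ 2 :* v :* iv :+ κ 1) :* (A :* a :+ r) :* iv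
                     :- (κ 2 :* v :* iv :- κ 1) :* ((κ 2 :* v :* iv) :* (κ 2 :* v :* iv) :+ κ 2 :* v :* iv :+ κ 1))
                :+ (b :* (a :* a) :- v) :* (a :* (((A :* a :+ r) :* iv) :* (((A :* a :+ r) :* iv) :* ((A :* a :+ r) :* iv))))) refl a A r v iv b)
            T-root v-root inverse b-def
            (solve 6 (λ a s r v iv b → a :* (iv :* iv :* iv :* (v :* (κ 3 :* s :+ r) :* κ 0 :+ κ 8 :* v :* κ 0)
                                       :- κ 0 :* (κ 2 :* v :* iv :+ κ 1) :* (s :+ r) :* iv
                                       :- κ 0 :* ((κ 2 :* v :* iv) :* (κ 2 :* v :* iv) :+ κ 2 :* v :* iv :+ κ 1))
                                  :+ κ 0 :* (a :* (((s :+ r) :* iv) :* (((s :+ r) :* iv) :* ((s :+ r) :* iv)))) := κ 0) refl a s r v iv b)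

        contradiction : ⊥
        contradiction = x≢0 (fab-injective (trans (fab≡0 0<q x≢0 x^q≡yx y^q*y≡1 by³+y+a≡0) (sym (zeroˡ _))))
          where
          x : Carrier
          x = proj₁ (hilbert90 y^q*y≡1)
          x≢0 : x ≢ 0#
          x≢0 = proj₁ (proj₂ (hilbert90 y^q*y≡1))
          x^q≡yx : x ^ q ≡ y * x
          x^q≡yx = proj₂ (proj₂ (hilbert90 y^q*y≡1))

      discriminant-square : NonzeroSquareIn q t
      discriminant-square = decide (t ≟ 0#) (any? (λ w → (w ^ q ≟ w) ×-dec (w * w ≟ t)))
        where
        decide : Dec (t ≡ 0#) → Dec (∃ λ w → w ^ q ≡ w × w * w ≡ t) → NonzeroSquareIn q t
        decide (yes t≡0) _ = ⊥-elim (ConjugateRoot.contradiction 0# (trans (zeroˡ 0#) (sym t≡0)) (trans (0^n≡0 0<q) (sym -0#≡0#)))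
        decide (no t≢0) (yes (w , w^q≡w , w*w≡t)) = t≢0 , t^q≡t , w , w^q≡w , w*w≡t
        decide (no t≢0) (no no-root) = ⊥-elim (ConjugateRoot.contradiction r r*r≡t
          (r^n≡-r q r*r≡t t^q≡t (λ w w^q≡w w*w≡t → no-root (w , w^q≡w , w*w≡t))))
          where
          r : Carrier
          r = proj₁ (square-root t^q≡t)
          r*r≡t : r * r ≡ t
          r*r≡t = proj₂ (square-root t^q≡t)

proposition3p1 : (p h : ℕ) → Prime p → 3 < p → 1 ≤ h →
    (F : FiniteField (ℕ._^_ p (2 ℕ.* h))) →
    let open FiniteField F
        open FF F
        q = ℕ._^_ p h
    in (a b : Carrier) → a ≢ 0# → b ≢ 0# →
       Bijective _≡_ _≡_ (fab q a b) →
       GcdHasDegree (b ^ q ∷ 0# ∷ 1# ∷ a ^ q ∷ []) (a ∷ 1# ∷ 0# ∷ b ∷ []) 2 →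
       ∃ λ v → InSubfield q v × v ≢ 0# ×
         b ≡ v * (a ^ 2) ⁻¹ ×
         (v * v - a ^ (q ℕ.+ 1) * v - a ^ (3 ℕ.* q ℕ.+ 3)) ≡ 0# ×
         NonzeroSquareIn q (- (fromℕ 3 * a ^ (2 ℕ.* q ℕ.+ 2)) - fromℕ 4 * v)
proposition3p1 p h p-prime 3<p _ F a b a≢0 b≢0 (fab-injective , _) ((D , deg-D , D∣second , D∣first) , _) =
  v , v^q≡v , v≢0 , b≡v/a² , v-quadratic , discriminant-square
  where
  open FiniteFieldTheory F
  open QuadraticExtension p-prime (ℕₚ.<-trans (ℕₚ.n<1+n 2) 3<p) h refl
  open Proposition3p1 a≢0 b≢0 fab-injective (D , deg-D , D∣first , D∣second)
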